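{- Let $\rho,\varepsilon$ be reals with $0<\rho\le\varepsilon/4\ll1$, let $n\in3\mathbb{Z}$ be sufficiently large, and let $H$ be a $(1,3)$-partite $4$-graph with partition classes $Q,P$ such that $3|Q|=|P|=n$ and $d_H(\{u,v\})\ge\binom{n-1}{2}-\binom{2n/3}{2}-\rho n^2$ for all $v\in Q$ and $u\in P$. If $H$ is not $\varepsilon$-close to any copy of $H_{1,3}(n,n/3)$ on $V(H)$, then $H$ is $(\mathcal{F},\varepsilon/6)$-dense, where $\mathcal{F}=\{A\subseteq V(H): |A\cap Q|\ge(1/3-\varepsilon/8)n \text{ and } |A\cap P|\ge(2/3-\varepsilon/8)n\}$.
   Context: A $4$-graph $H$ is $(1,3)$-partite with partition classes $Q,P$ if $V(H)=Q\cup P$ (disjoint) and every edge meets $Q$ in one vertex and $P$ in three. For $|Q|=n/3$, $|P|=n$, a copy of $H_{1,3}(n,n/3)$ on $Q\cup P$ is the $4$-graph with edge set $\{\{v\}\cup e: v\in Q,\ e\in\binom{P}{3},\ e\cap W\neq\emptyset,\ e\not\subseteq W\}$ for some $W\subseteq P$ with $|W|=n/3$. For $k$-graphs $H_1,H_2$ on the same vertex set, $H_2$ is $\varepsilon$-close to $H_1$ if $|E(H_1)\setminus E(H_2)|<\varepsilon|V(H_1)|^k$. For a family $\mathcal{F}$ of subsets of $V(H)$, $H$ is $(\mathcal{F},\varepsilon)$-dense if $e(H[A])\ge\varepsilon\, e(H)$ for every $A\in\mathcal{F}$, where $e(\cdot)$ is the number of edges. $d_H(T)$ is the number of edges containing 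$T$.
   Formalization: The parameters ρ and ε range over the rationals instead of the reals. -}

module Defs where

open import Data.Nat using (ℕ; zero; suc; _+_; _*_)
open import Data.Bool using (Bool; true; false; _∧_; _∨_; not; if_then_else_)
open import Data.Fin using (Fin; _<?_; _≟_)
open import Data.Fin.Subset using (Subset)
open import Data.Vec using (lookup)
open import Data.Integer using (+_)
open import Data.Rational using (ℚ; _/_; _<_) renaming (_*_ to _*ℚ_)
open import Relation.Nullary.Decidable using (⌊_⌋)

ℕ→ℚ : ℕ → ℚ
ℕ→ℚ n = + n / 1

sumF : ∀ {k} → (Fin k → ℕ) → ℕ
sumF {zero}  f = 0
sumF {suc k} f = f Fin.zero + sumF (λ i → f (Fin.suc i))
  where import Data.Fin as Fin

[_] : Bool → ℕ
[ b ] = if b then 1 else 0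

-- A (1,3)-partite 4-graph with classes Q = Fin m and P = Fin (3m) (so |P| = n = 3m).
-- The 4-set {v,a,b,c} (v ∈ Q; a,b,c ∈ P) is an edge iff  H v a b c ≡ true  for the
-- increasing listing a < b < c; values at non-increasing triples are irrelevant.
Graph13 : ℕ → Set
Graph13 m = Fin m → Fin (3 * m) → Fin (3 * m) → Fin (3 * m) → Bool

inc : ∀ {k} → Fin k → Fin k → Fin k → Bool
inc a b c = ⌊ a <? b ⌋ ∧ ⌊ b <? c ⌋

countEdges : ∀ {m} → (Fin m → Fin (3 * m) → Fin (3 * m) → Fin (3 * m) → Bool) → ℕ
countEdges G = sumF λ v → sumF λ a → sumF λ b → sumF λ c → [ inc a b c ∧ G v a b c ]

e : ∀ {m} → Graph13 m → ℕ
e H = countEdges H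

deg : ∀ {m} → Graph13 m → Fin m → Fin (3 * m) → ℕ
deg H v u = countEdges λ v' a b c →
  ⌊ v' ≟ v ⌋ ∧ (⌊ a ≟ u ⌋ ∨ ⌊ b ≟ u ⌋ ∨ ⌊ c ≟ u ⌋) ∧ H v' a b c

eInduced : ∀ {m} → Graph13 m → Subset m → Subset (3 * m) → ℕ
eInduced H AQ AP = countEdges λ v a b c →
  lookup AQ v ∧ lookup AP a ∧ lookup AP b ∧ lookup AP c ∧ H v a b c

H13copy : ∀ {m} → Subset (3 * m) → Graph13 m
H13copy W v a b c =
  (lookup W a ∨ lookup W b ∨ lookup W c) ∧ not (lookup W a ∧ lookup W b ∧ lookup W c)

missing : ∀ {m} → Graph13 m → Graph13 m → ℕ
missing H1 H2 = countEdges λ v a b c → H1 v a b c ∧ not (H2 v a b c)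

-- H2 is ε-close to H1 (|V| = m + 3m = 4m, k = 4)
Close : ℚ → ∀ {m} → Graph13 m → Graph13 m → Set
Close ε {m} H2 H1 = ℕ→ℚ (missing H1 H2) < ε *ℚ ℕ→ℚ ((4 * m) * (4 * m) * (4 * m) * (4 * m))

module Submission where

-- Suppose some A = AQ ∪ AP in 𝓕 had e(H[A]) < (ε/6) e(H). Pick W ⊆ P with |W| = n/3 that either
-- avoids AP or covers P ∖ AP; then S = AP ∖ W and D = P ∖ (AP ∪ W) satisfy |S| + |D| = 2n/3 and
-- |D| ≤ (ε/8) n. For v ∈ AQ, charge every edge {v} ∪ T of the copy of H₁₃(n, n/3) on W that is
-- missing from H to a vertex u ∈ T ∖ W. A vertex u ∈ D receives at most C(n−1,2) charges. For u ∈ S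
-- the codegree condition leaves at most ρn² + C(2n/3,2) − C(|S|−1,2) + x_u non-edges of the link
-- of v through u that leave S, where x_u counts the link edges through u inside S, and
-- Σ_u x_u ≤ 3 e(H_v[S]). Bounding the vertices of Q ∖ AQ trivially, fewer than ε (4n/3)⁴ edges of
-- the copy are missing, so H would be ε-close to it.

module Counting where

  open import Defs
  open import Data.Bool using (Bool; true; false; _∧_; _∨_; not)
  open import Data.Bool.Properties using (∧-identityʳ; ∧-zeroʳ; ∨-zeroʳ)
  open import Data.Nat
    using (ℕ; zero; suc; _+_; _*_; _∸_; _≤_; _<_; _⊔_; _⊓_; z≤n; s≤s)
  open import Data.Nat.Properties hiding (_≟_; _<?_)
  open import Data.Nat.Combinatorics using (_C_; nC1≡n; nCk+nC[k+1]≡[n+1]C[k+1])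
  open import Data.Fin using (Fin; zero; suc; _<?_; _≟_)
  open import Data.Fin.Subset using (Subset; ∣_∣; ∁; _∪_)
  open import Data.Vec using ([]; _∷_; lookup)
  open import Data.Vec.Properties using (lookup-map; lookup-zipWith)
  open import Data.Product using (Σ; _×_; _,_)
  open import Data.Sum using (_⊎_; inj₁; inj₂)
  open import Function using (_∘_; case_of_)
  open import Relation.Binary.PropositionalEquality
    using (_≡_; refl; sym; trans; cong; cong₂; subst; module ≡-Reasoning)
  open import Relation.Nullary.Decidable using (⌊_⌋; does; isYes≗does; yes; no)
  open import Algebra.Properties.Semiring.Sum +-*-semiring
    using (sum; sum-syntax; sum-cong-≗; ∑-distrib-+; ∑-comm; *-distribˡ-sum; *-distribʳ-sum; sum-replicate-zero)
  open import Algebra.Properties.CommutativeSemigroup *-commutativeSemigroup using (x∙yz≈y∙xz)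
  open import Data.Nat.Tactic.RingSolver using (solve-∀)

  -- Finite sums over Fin

  sumF≗sum : ∀ {k} {f g : Fin k → ℕ} → (∀ i → f i ≡ g i) → sumF f ≡ sum g
  sumF≗sum {zero}  f≗g = refl
  sumF≗sum {suc k} f≗g = cong₂ _+_ (f≗g zero) (sumF≗sum (f≗g ∘ suc))

  sum-mono-≤ : ∀ {k} {f g : Fin k → ℕ} → (∀ i → f i ≤ g i) → sum f ≤ sum g
  sum-mono-≤ {zero}  f≤g = z≤n
  sum-mono-≤ {suc k} f≤g = +-mono-≤ (f≤g zero) (sum-mono-≤ (f≤g ∘ suc))

  sum-const : ∀ k c → ∑[ i < k ] c ≡ k * c
  sum-const zero    c = refl
  sum-const (suc k) c = cong (c +_) (sum-const k c)

  ≤-sum : ∀ {k} (f : Fin k → ℕ) i → f i ≤ sum f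
  ≤-sum f zero    = m≤m+n _ _
  ≤-sum f (suc i) = ≤-trans (≤-sum (f ∘ suc) i) (m≤n+m _ _)

  maxᶠ : ∀ {k} → (Fin k → ℕ) → ℕ
  maxᶠ {zero}  f = 0
  maxᶠ {suc k} f = f zero ⊔ maxᶠ (f ∘ suc)

  ≤-maxᶠ : ∀ {k} (f : Fin k → ℕ) i → f i ≤ maxᶠ f
  ≤-maxᶠ f zero    = m≤m⊔n _ _
  ≤-maxᶠ f (suc i) = ≤-trans (≤-maxᶠ (f ∘ suc) i) (m≤n⊔m _ _)

  -- Unlike ⌊ a ≟ b ⌋ and ⌊ a <? b ⌋, these reduce on suc a, suc b.
  _≡ᵇ_ : ∀ {n} → Fin n → Fin n → Bool
  zero  ≡ᵇ zero  = true
  suc a ≡ᵇ suc b = a ≡ᵇ b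
  _     ≡ᵇ _     = false

  _<ᵇ_ : ∀ {n} → Fin n → Fin n → Bool
  _     <ᵇ zero  = false
  zero  <ᵇ suc _ = true
  suc a <ᵇ suc b = a <ᵇ b

  ⌊≟⌋≡≡ᵇ : ∀ {n} (a b : Fin n) → ⌊ a ≟ b ⌋ ≡ a ≡ᵇ b
  ⌊≟⌋≡≡ᵇ a b = trans (isYes≗does (a ≟ b)) (does-≟ a b)
    where
    does-≟ : ∀ {n} (a b : Fin n) → does (a ≟ b) ≡ a ≡ᵇ b
    does-≟ zero    zero    = refl
    does-≟ zero    (suc b) = refl
    does-≟ (suc a) zero    = refl
    does-≟ (suc a) (suc b) = does-≟ a b

  ⌊<?⌋≡<ᵇ : ∀ {n} (a b : Fin n) → ⌊ a <? b ⌋ ≡ a <ᵇ b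
  ⌊<?⌋≡<ᵇ a b = trans (isYes≗does (a <? b)) (does-<? a b)
    where
    does-<? : ∀ {n} (a b : Fin n) → does (a <? b) ≡ a <ᵇ b
    does-<? zero    zero    = refl
    does-<? zero    (suc b) = refl
    does-<? (suc a) zero    = refl
    does-<? (suc a) (suc b) = does-<? a b

  ≡ᵇ-refl : ∀ {n} (a : Fin n) → a ≡ᵇ a ≡ true
  ≡ᵇ-refl zero    = refl
  ≡ᵇ-refl (suc a) = ≡ᵇ-refl a

  ≡ᵇ-sym : ∀ {n} (a b : Fin n) → a ≡ᵇ b ≡ b ≡ᵇ a
  ≡ᵇ-sym zero    zero    = refl
  ≡ᵇ-sym zero    (suc b) = refl
  ≡ᵇ-sym (suc a) zero    = refl
  ≡ᵇ-sym (suc a) (suc b) = ≡ᵇ-sym a b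

  ∑-δ : ∀ {n} (j : Fin n) (f : Fin n → ℕ) → ∑[ i < n ] ([ i ≡ᵇ j ] * f i) ≡ f j
  ∑-δ {suc n} zero    f = trans (cong (f zero + 0 +_) (sum-replicate-zero n)) (trans (+-identityʳ _) (+-identityʳ _))
  ∑-δ {suc n} (suc j) f = ∑-δ j (f ∘ suc)

  ∑-[≡ᵇ] : ∀ {n} (a : Fin n) → ∑[ u < n ] [ a ≡ᵇ u ] ≡ 1
  ∑-[≡ᵇ] {n} a = trans (sum-cong-≗ λ u → trans (cong [_] (≡ᵇ-sym a u)) (sym (*-identityʳ [ u ≡ᵇ a ])))
                       (∑-δ a (λ _ → 1))

  [∧]≡[]*[] : ∀ x y → [ x ∧ y ] ≡ [ x ] * [ y ]
  [∧]≡[]*[] false y = refl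
  [∧]≡[]*[] true  y = sym (+-identityʳ [ y ])

  []≤1 : ∀ x → [ x ] ≤ 1
  []≤1 false = z≤n
  []≤1 true  = s≤s z≤n

  [∨]≤[]+[] : ∀ x y → [ x ∨ y ] ≤ [ x ] + [ y ]
  [∨]≤[]+[] false y = ≤-refl
  [∨]≤[]+[] true  y = s≤s z≤n

  count : ∀ {n} → (Fin n → Bool) → ℕ
  count {n} R = ∑[ i < n ] [ R i ]

  ∣s∣≡count : ∀ {n} (s : Subset n) → ∣ s ∣ ≡ count (lookup s)
  ∣s∣≡count []          = refl
  ∣s∣≡count (true ∷ s)  = cong suc (∣s∣≡count s)
  ∣s∣≡count (false ∷ s) = ∣s∣≡count s

  count-true : ∀ n → count {n} (λ _ → true) ≡ n
  count-true n = trans (sum-const n 1) (*-identityʳ n)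

  count-∁ : ∀ {k} (s : Subset k) → count (not ∘ lookup s) + ∣ s ∣ ≡ k
  count-∁ []          = refl
  count-∁ (true ∷ s)  = trans (+-suc _ _) (cong suc (count-∁ s))
  count-∁ (false ∷ s) = cong suc (count-∁ s)

  ∑[∧]≡[]*count : ∀ {n} x (R : Fin n → Bool) → ∑[ i < n ] [ x ∧ R i ] ≡ [ x ] * count R
  ∑[∧]≡[]*count x R = trans (sum-cong-≗ (λ i → [∧]≡[]*[] x (R i))) (sym (*-distribˡ-sum [ x ] (λ i → [ R i ])))

  ∑[]*≡count* : ∀ {n} (R : Fin n → Bool) z → ∑[ i < n ] ([ R i ] * z) ≡ count R * z
  ∑[]*≡count* R z = sym (*-distribʳ-sum z (λ i → [ R i ]))

  _─_ : ∀ {n} → (Fin n → Bool) → Fin n → Fin n → Bool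
  (R ─ u) i = not (i ≡ᵇ u) ∧ R i

  count-─ : ∀ {n} (R : Fin n → Bool) u → count R ≡ count (R ─ u) + [ R u ]
  count-─ {n} R u = begin
    count R                                                 ≡⟨ sum-cong-≗ (λ i → split (i ≡ᵇ u) (R i)) ⟩
    ∑[ i < n ] ([ (R ─ u) i ] + [ i ≡ᵇ u ] * [ R i ])        ≡⟨ ∑-distrib-+ (λ i → [ (R ─ u) i ]) _ ⟩
    count (R ─ u) + ∑[ i < n ] ([ i ≡ᵇ u ] * [ R i ])        ≡⟨ cong (count (R ─ u) +_) (∑-δ u (λ i → [ R i ])) ⟩
    count (R ─ u) + [ R u ]                                 ∎
    where
    open ≡-Reasoning
    split : ∀ p r → [ r ] ≡ [ not p ∧ r ] + [ p ] * [ r ]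
    split false r = sym (+-identityʳ [ r ])
    split true  r = sym (+-identityʳ [ r ])

  pascal : ∀ x s k → [ x ] * (s C k) + s C suc k ≡ ([ x ] + s) C suc k
  pascal false s k = refl
  pascal true  s k = trans (cong (_+ s C suc k) (+-identityʳ (s C k))) (nCk+nC[k+1]≡[n+1]C[k+1] s k)

  -- Sums over increasing pairs and triples

  -- ∑<₂ and ∑<₃ are opaque so that Agda can infer G from ∑<₂ G and ∑<₃ G by unification.
  opaque
    ∑<₂ : ∀ {n} → (Fin n → Fin n → ℕ) → ℕ
    ∑<₂ {n} G = ∑[ b < n ] ∑[ c < n ] ([ b <ᵇ c ] * G b c)

  opaque
    unfolding ∑<₂

    ∑<₂-cong : ∀ {n} {G K : Fin n → Fin n → ℕ} → (∀ b c → G b c ≡ K b c) → ∑<₂ G ≡ ∑<₂ K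
    ∑<₂-cong G≡K = sum-cong-≗ λ b → sum-cong-≗ λ c → cong ([ b <ᵇ c ] *_) (G≡K b c)

    ∑<₂-mono : ∀ {n} {G K : Fin n → Fin n → ℕ} → (∀ b c → G b c ≤ K b c) → ∑<₂ G ≤ ∑<₂ K
    ∑<₂-mono G≤K = sum-mono-≤ λ b → sum-mono-≤ λ c → *-monoʳ-≤ [ b <ᵇ c ] (G≤K b c)

    ∑<₂-+ : ∀ {n} (G K : Fin n → Fin n → ℕ) → ∑<₂ (λ b c → G b c + K b c) ≡ ∑<₂ G + ∑<₂ K
    ∑<₂-+ {n} G K = trans
      (sum-cong-≗ λ b → trans (sum-cong-≗ λ c → *-distribˡ-+ [ b <ᵇ c ] (G b c) (K b c))
                              (∑-distrib-+ (λ c → [ b <ᵇ c ] * G b c) (λ c → [ b <ᵇ c ] * K b c)))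
      (∑-distrib-+ (λ b → ∑[ c < n ] ([ b <ᵇ c ] * G b c)) (λ b → ∑[ c < n ] ([ b <ᵇ c ] * K b c)))

    ∑<₂-*ˡ : ∀ {n} x (G : Fin n → Fin n → ℕ) → ∑<₂ (λ b c → x * G b c) ≡ x * ∑<₂ G
    ∑<₂-*ˡ {n} x G = sym (trans (*-distribˡ-sum x (λ b → ∑[ c < n ] ([ b <ᵇ c ] * G b c)))
      (sum-cong-≗ λ b → trans (*-distribˡ-sum x (λ c → [ b <ᵇ c ] * G b c))
                              (sum-cong-≗ λ c → x∙yz≈y∙xz x [ b <ᵇ c ] (G b c))))

    ∑<₂-∑ : ∀ {n k} (F : Fin k → Fin n → Fin n → ℕ) → ∑<₂ (λ b c → ∑[ u < k ] F u b c) ≡ ∑[ u < k ] ∑<₂ (F u)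
    ∑<₂-∑ {n} {k} F = begin
      ∑[ b < n ] ∑[ c < n ] ([ b <ᵇ c ] * ∑[ u < k ] F u b c)
        ≡⟨ sum-cong-≗ (λ b → sum-cong-≗ λ c → *-distribˡ-sum [ b <ᵇ c ] (λ u → F u b c)) ⟩
      ∑[ b < n ] ∑[ c < n ] ∑[ u < k ] ([ b <ᵇ c ] * F u b c)
        ≡⟨ sum-cong-≗ (λ b → ∑-comm (λ c u → [ b <ᵇ c ] * F u b c)) ⟩
      ∑[ b < n ] ∑[ u < k ] ∑[ c < n ] ([ b <ᵇ c ] * F u b c)
        ≡⟨ ∑-comm (λ b u → ∑[ c < n ] ([ b <ᵇ c ] * F u b c)) ⟩
      ∑[ u < k ] ∑<₂ (F u)                                      ∎
      where open ≡-Reasoning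

    ∑<₂-suc : ∀ {n} (G : Fin (suc n) → Fin (suc n) → ℕ) →
              ∑<₂ G ≡ ∑[ c < n ] G zero (suc c) + ∑<₂ (λ b c → G (suc b) (suc c))
    ∑<₂-suc {n} G = cong (_+ ∑<₂ (λ b c → G (suc b) (suc c))) (sum-cong-≗ λ c → *-identityˡ (G zero (suc c)))

    ∑<₂-zero : (G : Fin 0 → Fin 0 → ℕ) → ∑<₂ G ≡ 0
    ∑<₂-zero G = refl

    ∑<₂-bound : ∀ {n} (G : Fin n → Fin n → ℕ) → (∀ b c → G b c ≤ 1) → ∑<₂ G ≤ n * n
    ∑<₂-bound {n} G G≤1 = begin
      ∑<₂ G                   ≤⟨ sum-mono-≤ (λ b → sum-mono-≤ λ c → *-mono-≤ ([]≤1 (b <ᵇ c)) (G≤1 b c)) ⟩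
      ∑[ b < n ] ∑[ c < n ] 1  ≡⟨ sum-cong-≗ {n} (λ b → sum-const n 1) ⟩
      ∑[ b < n ] (n * 1)      ≡⟨ sum-const n (n * 1) ⟩
      n * (n * 1)             ≡⟨ cong (n *_) (*-identityʳ n) ⟩
      n * n                   ∎
      where open ≤-Reasoning

  opaque
    ∑<₃ : ∀ {n} → (Fin n → Fin n → Fin n → ℕ) → ℕ
    ∑<₃ {n} G = ∑[ a < n ] ∑<₂ (λ b c → [ a <ᵇ b ] * G a b c)

  opaque
    unfolding ∑<₃

    ∑<₃-suc : ∀ {n} (G : Fin (suc n) → Fin (suc n) → Fin (suc n) → ℕ) →
              ∑<₃ G ≡ ∑<₂ (λ b c → G zero (suc b) (suc c)) + ∑<₃ (λ a b c → G (suc a) (suc b) (suc c))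
    ∑<₃-suc {n} G = cong₂ _+_
      (begin
        ∑<₂ (λ b c → [ zero <ᵇ b ] * G zero b c)
          ≡⟨ ∑<₂-suc (λ b c → [ zero <ᵇ b ] * G zero b c) ⟩
        ∑[ c < n ] 0 + ∑<₂ (λ b c → 1 * G zero (suc b) (suc c))
          ≡⟨ cong₂ _+_ (sum-replicate-zero n) (∑<₂-cong λ b c → *-identityˡ _) ⟩
        ∑<₂ (λ b c → G zero (suc b) (suc c))                     ∎)
      (sum-cong-≗ λ a → trans (∑<₂-suc (λ b c → [ suc a <ᵇ b ] * G (suc a) b c))
                              (cong (_+ ∑<₂ (λ b c → [ a <ᵇ b ] * G (suc a) (suc b) (suc c))) (sum-replicate-zero n)))
      where open ≡-Reasoning

    ∑<₃-zero : (G : Fin 0 → Fin 0 → Fin 0 → ℕ) → ∑<₃ G ≡ 0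
    ∑<₃-zero G = refl

    ∑<₃-cong : ∀ {n} {G K : Fin n → Fin n → Fin n → ℕ} → (∀ a b c → G a b c ≡ K a b c) → ∑<₃ G ≡ ∑<₃ K
    ∑<₃-cong G≡K = sum-cong-≗ λ a → ∑<₂-cong λ b c → cong ([ a <ᵇ b ] *_) (G≡K a b c)

    ∑<₃-mono : ∀ {n} {G K : Fin n → Fin n → Fin n → ℕ} → (∀ a b c → G a b c ≤ K a b c) → ∑<₃ G ≤ ∑<₃ K
    ∑<₃-mono G≤K = sum-mono-≤ λ a → ∑<₂-mono λ b c → *-monoʳ-≤ [ a <ᵇ b ] (G≤K a b c)

    ∑<₃-+ : ∀ {n} (G K : Fin n → Fin n → Fin n → ℕ) → ∑<₃ (λ a b c → G a b c + K a b c) ≡ ∑<₃ G + ∑<₃ K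
    ∑<₃-+ G K = trans
      (sum-cong-≗ λ a → trans (∑<₂-cong λ b c → *-distribˡ-+ [ a <ᵇ b ] (G a b c) (K a b c))
                              (∑<₂-+ (λ b c → [ a <ᵇ b ] * G a b c) (λ b c → [ a <ᵇ b ] * K a b c)))
      (∑-distrib-+ (λ a → ∑<₂ (λ b c → [ a <ᵇ b ] * G a b c)) (λ a → ∑<₂ (λ b c → [ a <ᵇ b ] * K a b c)))

    ∑<₃-*ˡ : ∀ {n} x (G : Fin n → Fin n → Fin n → ℕ) → ∑<₃ (λ a b c → x * G a b c) ≡ x * ∑<₃ G
    ∑<₃-*ˡ x G = trans
      (sum-cong-≗ λ a → trans (∑<₂-cong λ b c → x∙yz≈y∙xz [ a <ᵇ b ] x (G a b c)) (∑<₂-*ˡ x (λ b c → [ a <ᵇ b ] * G a b c)))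
      (sym (*-distribˡ-sum x (λ a → ∑<₂ (λ b c → [ a <ᵇ b ] * G a b c))))

    ∑<₃-∑ : ∀ {n k} (F : Fin k → Fin n → Fin n → Fin n → ℕ) →
            ∑<₃ (λ a b c → ∑[ u < k ] F u a b c) ≡ ∑[ u < k ] ∑<₃ (F u)
    ∑<₃-∑ {n} {k} F = trans
      (sum-cong-≗ λ a → trans (∑<₂-cong λ b c → *-distribˡ-sum [ a <ᵇ b ] (λ u → F u a b c))
                              (∑<₂-∑ λ u b c → [ a <ᵇ b ] * F u a b c))
      (∑-comm λ a u → ∑<₂ (λ b c → [ a <ᵇ b ] * F u a b c))

    ∑<₃-bound : ∀ {n} (G : Fin n → Fin n → Fin n → ℕ) → (∀ a b c → G a b c ≤ 1) → ∑<₃ G ≤ n * (n * n)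
    ∑<₃-bound {n} G G≤1 = begin
      ∑<₃ G              ≤⟨ sum-mono-≤ (λ a → ∑<₂-bound _ λ b c → *-mono-≤ ([]≤1 (a <ᵇ b)) (G≤1 a b c)) ⟩
      ∑[ a < n ] (n * n)  ≡⟨ sum-const n (n * n) ⟩
      n * (n * n)        ∎
      where open ≤-Reasoning

  opaque
    unfolding ∑<₂ ∑<₃

    countEdges≡∑∑<₃ : ∀ {m} (G : Fin m → Fin (3 * m) → Fin (3 * m) → Fin (3 * m) → Bool) →
                     countEdges G ≡ ∑[ v < m ] ∑<₃ (λ a b c → [ G v a b c ])
    countEdges≡∑∑<₃ {m} G =
      sumF≗sum λ v → sumF≗sum λ a → sumF≗sum λ b → sumF≗sum λ c → ordered a b c (G v a b c)
      where
      reorder : ∀ p q x → [ (p ∧ q) ∧ x ] ≡ [ q ] * ([ p ] * [ x ])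
      reorder false false x     = refl
      reorder false true  x     = refl
      reorder true  false x     = refl
      reorder true  true  false = refl
      reorder true  true  true  = refl
      ordered : ∀ (a b c : Fin (3 * m)) x → [ inc a b c ∧ x ] ≡ [ b <ᵇ c ] * ([ a <ᵇ b ] * [ x ])
      ordered a b c x rewrite ⌊<?⌋≡<ᵇ a b | ⌊<?⌋≡<ᵇ b c = reorder (a <ᵇ b) (b <ᵇ c) x

  ∑<₂-[∧] : ∀ {n} x (G : Fin n → Fin n → Bool) → ∑<₂ (λ b c → [ x ∧ G b c ]) ≡ [ x ] * ∑<₂ (λ b c → [ G b c ])
  ∑<₂-[∧] x G = trans (∑<₂-cong λ b c → [∧]≡[]*[] x (G b c)) (∑<₂-*ˡ [ x ] _)

  ∑<₃-[∧] : ∀ {n} x (G : Fin n → Fin n → Fin n → Bool) →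
            ∑<₃ (λ a b c → [ x ∧ G a b c ]) ≡ [ x ] * ∑<₃ (λ a b c → [ G a b c ])
  ∑<₃-[∧] x G = trans (∑<₃-cong λ a b c → [∧]≡[]*[] x (G a b c)) (∑<₃-*ˡ [ x ] _)

  inside : ∀ {n} → (Fin n → Bool) → Fin n → Fin n → Fin n → Bool
  inside R a b c = R a ∧ R b ∧ R c

  through : ∀ {n} → Fin n → Fin n → Fin n → Fin n → Bool
  through u a b c = a ≡ᵇ u ∨ b ≡ᵇ u ∨ c ≡ᵇ u

  ∑<₂-count : ∀ {n} (R : Fin n → Bool) → ∑<₂ (λ b c → [ R b ∧ R c ]) ≡ count R C 2
  ∑<₂-count {zero}  R = ∑<₂-zero _
  ∑<₂-count {suc n} R = begin
    ∑<₂ (λ b c → [ R b ∧ R c ])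
      ≡⟨ ∑<₂-suc _ ⟩
    ∑[ c < n ] [ R zero ∧ R′ c ] + ∑<₂ (λ b c → [ R′ b ∧ R′ c ])
      ≡⟨ cong₂ _+_ (∑[∧]≡[]*count (R zero) R′) (∑<₂-count R′) ⟩
    [ R zero ] * count R′ + count R′ C 2
      ≡⟨ cong (λ k → [ R zero ] * k + count R′ C 2) (sym (nC1≡n (count R′))) ⟩
    [ R zero ] * (count R′ C 1) + count R′ C 2
      ≡⟨ pascal (R zero) (count R′) 1 ⟩
    count R C 2 ∎
    where
    open ≡-Reasoning
    R′ = R ∘ suc

  ∑<₃-count : ∀ {n} (R : Fin n → Bool) → ∑<₃ (λ a b c → [ inside R a b c ]) ≡ count R C 3
  ∑<₃-count {zero}  R = ∑<₃-zero _
  ∑<₃-count {suc n} R = begin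
    ∑<₃ (λ a b c → [ inside R a b c ])
      ≡⟨ ∑<₃-suc _ ⟩
    ∑<₂ (λ b c → [ R zero ∧ R′ b ∧ R′ c ]) + ∑<₃ (λ a b c → [ inside R′ a b c ])
      ≡⟨ cong₂ _+_ (trans (∑<₂-[∧] (R zero) _) (cong ([ R zero ] *_) (∑<₂-count R′))) (∑<₃-count R′) ⟩
    [ R zero ] * (count R′ C 2) + count R′ C 3
      ≡⟨ pascal (R zero) (count R′) 2 ⟩
    count R C 3 ∎
    where
    open ≡-Reasoning
    R′ = R ∘ suc

  inside-─ : ∀ {n} (R : Fin n → Bool) (u a b c : Fin n) →
             [ inside R a b c ] ≡ [ inside (R ─ u) a b c ] + [ through u a b c ∧ inside R a b c ]
  inside-─ R u a b c = split (a ≡ᵇ u) (b ≡ᵇ u) (c ≡ᵇ u) (R a) (R b) (R c)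
    where
    split : ∀ p q r x y z →
            [ x ∧ y ∧ z ] ≡ [ (not p ∧ x) ∧ (not q ∧ y) ∧ (not r ∧ z) ] + [ (p ∨ q ∨ r) ∧ (x ∧ y ∧ z) ]
    split true  q     r     x     y     z = refl
    split false true  r     false y     z = refl
    split false true  r     true  y     z = refl
    split false false true  false y     z = refl
    split false false true  true  false z = refl
    split false false true  true  true  z = refl
    split false false false x     y     z = sym (+-identityʳ _)

  through-count : ∀ {n} (R : Fin n → Bool) u → R u ≡ true →
                  ∑<₃ (λ a b c → [ through u a b c ∧ inside R a b c ]) ≡ (count R ∸ 1) C 2
  through-count R u Ru = +-cancelˡ-≡ (k C 3) _ _ (begin
    k C 3 + X                ≡⟨ cong (_+ X) (sym (∑<₃-count (R ─ u))) ⟩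
    ∑<₃ (λ a b c → [ inside (R ─ u) a b c ]) + X
                             ≡⟨ sym (∑<₃-+ _ _) ⟩
    ∑<₃ (λ a b c → [ inside (R ─ u) a b c ] + [ through u a b c ∧ inside R a b c ])
                             ≡⟨ sym (∑<₃-cong (inside-─ R u)) ⟩
    ∑<₃ (λ a b c → [ inside R a b c ])
                             ≡⟨ ∑<₃-count R ⟩
    count R C 3              ≡⟨ cong (_C 3) count≡1+k ⟩
    suc k C 3                ≡⟨ sym (nCk+nC[k+1]≡[n+1]C[k+1] k 2) ⟩
    k C 2 + k C 3            ≡⟨ +-comm (k C 2) (k C 3) ⟩
    k C 3 + k C 2            ≡⟨ cong (λ j → k C 3 + (j ∸ 1) C 2) (sym count≡1+k) ⟩
    k C 3 + (count R ∸ 1) C 2 ∎)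
    where
    open ≡-Reasoning
    k = count (R ─ u)
    X = ∑<₃ (λ a b c → [ through u a b c ∧ inside R a b c ])
    count≡1+k : count R ≡ suc k
    count≡1+k = trans (count-─ R u) (trans (cong (λ r → k + [ r ]) Ru) (+-comm k 1))

  through-first : ∀ {n} (a b c : Fin n) → through a a b c ≡ true
  through-first a b c rewrite ≡ᵇ-refl a = refl

  through-second : ∀ {n} (a b c : Fin n) → through b a b c ≡ true
  through-second a b c rewrite ≡ᵇ-refl b = ∨-zeroʳ (a ≡ᵇ b)

  through-third : ∀ {n} (a b c : Fin n) → through c a b c ≡ true
  through-third a b c rewrite ≡ᵇ-refl c = trans (cong (a ≡ᵇ c ∨_) (∨-zeroʳ (b ≡ᵇ c))) (∨-zeroʳ (a ≡ᵇ c))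

  ∑<₃-through : ∀ {n} (u : Fin n) → ∑<₃ (λ a b c → [ through u a b c ]) ≡ (n ∸ 1) C 2
  ∑<₃-through {n} u = begin
    ∑<₃ (λ a b c → [ through u a b c ])
      ≡⟨ ∑<₃-cong (λ a b c → cong [_] (sym (∧-identityʳ (through u a b c)))) ⟩
    ∑<₃ (λ a b c → [ through u a b c ∧ inside (λ _ → true) a b c ])
      ≡⟨ through-count (λ _ → true) u refl ⟩
    (count {n} (λ _ → true) ∸ 1) C 2
      ≡⟨ cong (λ k → (k ∸ 1) C 2) (count-true n) ⟩
    (n ∸ 1) C 2 ∎
    where open ≡-Reasoning

  ∑-through≤3 : ∀ {n} (a b c : Fin n) → ∑[ u < n ] [ through u a b c ] ≤ 3
  ∑-through≤3 {n} a b c = begin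
    ∑[ u < n ] [ through u a b c ]                      ≤⟨ sum-mono-≤ [through]≤ ⟩
    ∑[ u < n ] ([ a ≡ᵇ u ] + ([ b ≡ᵇ u ] + [ c ≡ᵇ u ]))  ≡⟨ ∑-distrib-+ (λ u → [ a ≡ᵇ u ]) _ ⟩
    ∑[ u < n ] [ a ≡ᵇ u ] + ∑[ u < n ] ([ b ≡ᵇ u ] + [ c ≡ᵇ u ])
      ≡⟨ cong₂ _+_ (∑-[≡ᵇ] a) (trans (∑-distrib-+ (λ u → [ b ≡ᵇ u ]) _) (cong₂ _+_ (∑-[≡ᵇ] b) (∑-[≡ᵇ] c))) ⟩
    3                                                   ∎
    where
    open ≤-Reasoning
    [through]≤ : ∀ u → [ through u a b c ] ≤ [ a ≡ᵇ u ] + ([ b ≡ᵇ u ] + [ c ≡ᵇ u ])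
    [through]≤ u = ≤-trans ([∨]≤[]+[] (a ≡ᵇ u) _) (+-monoʳ-≤ [ a ≡ᵇ u ] ([∨]≤[]+[] (b ≡ᵇ u) (c ≡ᵇ u)))

  suc-C2 : ∀ k → suc k C 2 ≡ k + k C 2
  suc-C2 k = trans (sym (nCk+nC[k+1]≡[n+1]C[k+1] k 1)) (cong (_+ k C 2) (nC1≡n k))

  C2-mono : ∀ {j k} → j ≤ k → j C 2 ≤ k C 2
  C2-mono {zero}          _         = z≤n
  C2-mono {suc j} {suc k} (s≤s j≤k) = begin
    suc j C 2  ≡⟨ suc-C2 j ⟩
    j + j C 2  ≤⟨ +-mono-≤ j≤k (C2-mono j≤k) ⟩
    k + k C 2  ≡⟨ suc-C2 k ⟨
    suc k C 2  ∎
    where open ≤-Reasoning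

  C2≤square : ∀ k → k C 2 ≤ k * k
  C2≤square zero    = z≤n
  C2≤square (suc k) = begin
    suc k C 2            ≡⟨ suc-C2 k ⟩
    k + k C 2            ≤⟨ +-monoʳ-≤ k (C2≤square k) ⟩
    k + k * k            ≤⟨ m≤n+m (k + k * k) (suc k) ⟩
    suc k + (k + k * k)  ≡⟨ cong (suc k +_) (*-suc k k) ⟨
    suc k * suc k        ∎
    where open ≤-Reasoning

  C2-+ : ∀ j k → (j + k) C 2 ≤ j C 2 + k * (j + k)
  C2-+ j zero    = ≤-reflexive (trans (cong (_C 2) (+-identityʳ j)) (sym (+-identityʳ (j C 2))))
  C2-+ j (suc k) = begin
    (j + suc k) C 2                  ≡⟨ cong (_C 2) (+-suc j k) ⟩
    suc (j + k) C 2                  ≡⟨ suc-C2 (j + k) ⟩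
    (j + k) + (j + k) C 2            ≤⟨ +-monoʳ-≤ (j + k) (C2-+ j k) ⟩
    (j + k) + (j C 2 + k * (j + k))  ≡⟨ rearrange j k (j C 2) ⟩
    j C 2 + suc k * (j + k)          ≤⟨ +-monoʳ-≤ (j C 2) (*-monoʳ-≤ (suc k) (m≤n+m (j + k) 1)) ⟩
    j C 2 + suc k * suc (j + k)      ≡⟨ cong (λ i → j C 2 + suc k * i) (sym (+-suc j k)) ⟩
    j C 2 + suc k * (j + suc k)      ∎
    where
    open ≤-Reasoning
    rearrange : ∀ j k c → (j + k) + (c + k * (j + k)) ≡ c + suc k * (j + k)
    rearrange = solve-∀

  C2-gap : ∀ {s d t} → s + d ≡ t → t C 2 ≤ (s ∸ 1) C 2 + (d + 1) * (t + 1)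
  C2-gap {s} {d} {t} s+d≡t = begin
    t C 2                                         ≤⟨ C2-mono t≤ ⟩
    (s ∸ 1 + (d + 1)) C 2                         ≤⟨ C2-+ (s ∸ 1) (d + 1) ⟩
    (s ∸ 1) C 2 + (d + 1) * (s ∸ 1 + (d + 1))      ≤⟨ +-monoʳ-≤ ((s ∸ 1) C 2) (*-monoʳ-≤ (d + 1) ≤t+1) ⟩
    (s ∸ 1) C 2 + (d + 1) * (t + 1)               ∎
    where
    open ≤-Reasoning
    t≤ : t ≤ s ∸ 1 + (d + 1)
    t≤ = begin
      t                ≡⟨ s+d≡t ⟨
      s + d            ≤⟨ +-monoˡ-≤ d (m≤n+m∸n s 1) ⟩
      1 + (s ∸ 1) + d  ≡⟨ reassoc (s ∸ 1) d ⟩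
      s ∸ 1 + (d + 1)  ∎
      where
      reassoc : ∀ x d → 1 + x + d ≡ x + (d + 1)
      reassoc = solve-∀
    ≤t+1 : s ∸ 1 + (d + 1) ≤ t + 1
    ≤t+1 = begin
      s ∸ 1 + (d + 1)  ≤⟨ +-monoˡ-≤ (d + 1) (m∸n≤m s 1) ⟩
      s + (d + 1)      ≡⟨ +-assoc s d 1 ⟨
      s + d + 1        ≡⟨ cong (_+ 1) s+d≡t ⟩
      t + 1            ∎

  -- The link of a vertex of Q against its link in a copy of H₁₃

  degree : ∀ {n} → (Fin n → Fin n → Fin n → Bool) → Fin n → ℕ
  degree L u = ∑<₃ λ a b c → [ through u a b c ∧ L a b c ]

  edgesInside : ∀ {n} → (Fin n → Fin n → Fin n → Bool) → (Fin n → Bool) → ℕ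
  edgesInside L R = ∑<₃ λ a b c → [ inside R a b c ∧ L a b c ]

  module Copy {n : ℕ} (W A : Fin n → Bool) where

    S D : Fin n → Bool
    S i = not (W i) ∧ A i
    D i = not (W i) ∧ not (A i)

    copy : Fin n → Fin n → Fin n → Bool
    copy a b c = (W a ∨ W b ∨ W c) ∧ not (W a ∧ W b ∧ W c)

    copy-witness : ∀ a b c → copy a b c ≡ true → Σ (Fin n) λ x → through x a b c ≡ true × W x ≡ false
    copy-witness a b c copy≡true with W a in Wa | W b in Wb | W c in Wc
    ... | false | _     | _     = a , through-first a b c , Wa
    ... | true  | false | _     = b , through-second a b c , Wb
    ... | true  | true  | false = c , through-third a b c , Wc
    ... | true  | true  | true  = case copy≡true of λ ()

    copy⇒¬insideS : ∀ a b c → copy a b c ≡ true → inside S a b c ≡ false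
    copy⇒¬insideS a b c copy≡true with W a | W b | W c
    ... | true  | _     | _     = refl
    ... | false | true  | _     = ∧-zeroʳ (A a)
    ... | false | false | true  = trans (cong (A a ∧_) (∧-zeroʳ (A b))) (∧-zeroʳ (A a))
    ... | false | false | false = case copy≡true of λ ()

    count-partition : count S + count D + count W ≡ n
    count-partition = begin
      count S + count D + count W                         ≡⟨ cong (_+ count W) (∑-distrib-+ (λ i → [ S i ]) _) ⟨
      ∑[ i < n ] ([ S i ] + [ D i ]) + count W           ≡⟨ ∑-distrib-+ (λ i → [ S i ] + [ D i ]) _ ⟨
      ∑[ i < n ] ([ S i ] + [ D i ] + [ W i ])           ≡⟨ sum-cong-≗ (λ i → partition (W i) (A i)) ⟩
      count {n} (λ _ → true)                             ≡⟨ count-true n ⟩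
      n                                                  ∎
      where
      open ≡-Reasoning
      partition : ∀ w a → [ not w ∧ a ] + [ not w ∧ not a ] + [ w ] ≡ 1
      partition true  a     = refl
      partition false true  = refl
      partition false false = refl

    module _ (L : Fin n → Fin n → Fin n → Bool) where

      copyMissing : ℕ
      copyMissing = ∑<₃ λ a b c → [ copy a b c ∧ not (L a b c) ]

      charge : Fin n → Fin n → Fin n → Fin n → ℕ
      charge u a b c = [ S u ] * [ through u a b c ∧ not (inside S a b c) ∧ not (L a b c) ] + [ D u ] * [ through u a b c ]

      charge-covers : ∀ a b c → [ copy a b c ∧ not (L a b c) ] ≤ ∑[ u < n ] charge u a b c
      charge-covers a b c with copy a b c in copy≡
      ... | false = z≤n
      ... | true with copy-witness a b c copy≡
      ...   | x , thr , Wx = ≤-trans charged (≤-sum (λ u → charge u a b c) x)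
        where
        charged : [ not (L a b c) ] ≤ charge x a b c
        charged rewrite thr | copy⇒¬insideS a b c copy≡ | Wx = either (A x) (L a b c)
          where
          either : ∀ α l → [ not l ] ≤ [ α ] * [ not l ] + [ not α ] * 1
          either true  false = ≤-refl
          either true  true  = z≤n
          either false false = ≤-refl
          either false true  = z≤n

      nonEdgesLeavingS : Fin n → ℕ
      nonEdgesLeavingS u = ∑<₃ λ a b c → [ through u a b c ∧ not (inside S a b c) ∧ not (L a b c) ]

      edgesInsideSThrough : Fin n → ℕ
      edgesInsideSThrough u = ∑<₃ λ a b c → [ through u a b c ∧ (inside S a b c ∧ L a b c) ]

      copyMissing≤charges : copyMissing ≤ ∑[ u < n ] ([ S u ] * nonEdgesLeavingS u + [ D u ] * ((n ∸ 1) C 2))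
      copyMissing≤charges = begin
        copyMissing                               ≤⟨ ∑<₃-mono charge-covers ⟩
        ∑<₃ (λ a b c → ∑[ u < n ] charge u a b c)  ≡⟨ ∑<₃-∑ charge ⟩
        ∑[ u < n ] ∑<₃ (charge u)                  ≡⟨ sum-cong-≗ charges ⟩
        ∑[ u < n ] ([ S u ] * nonEdgesLeavingS u + [ D u ] * ((n ∸ 1) C 2)) ∎
        where
        open ≤-Reasoning
        charges : ∀ u → ∑<₃ (charge u) ≡ [ S u ] * nonEdgesLeavingS u + [ D u ] * ((n ∸ 1) C 2)
        charges u = trans (∑<₃-+ _ _)
          (cong₂ _+_ (∑<₃-*ˡ [ S u ] λ a b c → [ through u a b c ∧ not (inside S a b c) ∧ not (L a b c) ])
                     (trans (∑<₃-*ˡ [ D u ] λ a b c → [ through u a b c ]) (cong ([ D u ] *_) (∑<₃-through u))))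

      through-split : (u : Fin n) → nonEdgesLeavingS u + ∑<₃ (λ a b c → [ through u a b c ∧ inside S a b c ]) + degree L u
                          ≡ (n ∸ 1) C 2 + edgesInsideSThrough u
      through-split u = begin
        nonEdgesLeavingS u + ∑<₃ (λ a b c → [ m a b c ∧ s a b c ]) + degree L u
          ≡⟨ cong (_+ degree L u) (∑<₃-+ _ _) ⟨
        ∑<₃ (λ a b c → [ m a b c ∧ not (s a b c) ∧ not (L a b c) ] + [ m a b c ∧ s a b c ]) + degree L u
          ≡⟨ ∑<₃-+ _ _ ⟨
        ∑<₃ (λ a b c → [ m a b c ∧ not (s a b c) ∧ not (L a b c) ] + [ m a b c ∧ s a b c ] + [ m a b c ∧ L a b c ])
          ≡⟨ ∑<₃-cong (λ a b c → split (m a b c) (s a b c) (L a b c)) ⟩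
        ∑<₃ (λ a b c → [ m a b c ] + [ m a b c ∧ (s a b c ∧ L a b c) ])
          ≡⟨ ∑<₃-+ _ _ ⟩
        ∑<₃ (λ a b c → [ m a b c ]) + edgesInsideSThrough u
          ≡⟨ cong (_+ edgesInsideSThrough u) (∑<₃-through u) ⟩
        (n ∸ 1) C 2 + edgesInsideSThrough u ∎
        where
        open ≡-Reasoning
        m = through u
        s = inside S
        split : ∀ m s l → [ m ∧ not s ∧ not l ] + [ m ∧ s ] + [ m ∧ l ] ≡ [ m ] + [ m ∧ (s ∧ l) ]
        split false s     l     = refl
        split true  true  l     = refl
        split true  false true  = refl
        split true  false false = refl

      nonEdgesLeavingS-≤ : ∀ Δ {t} (u : Fin n) → count S + count D ≡ t → (n ∸ 1) C 2 ≤ degree L u + t C 2 + Δ →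
                           S u ≡ true → nonEdgesLeavingS u ≤ Δ + (count D + 1) * (t + 1) + edgesInsideSThrough u
      nonEdgesLeavingS-≤ Δ {t} u S+D≡t T≤ Su = cancel (through-split u) (begin
        (n ∸ 1) C 2                               ≤⟨ T≤ ⟩
        degree L u + t C 2 + Δ                    ≤⟨ +-monoˡ-≤ Δ (+-monoʳ-≤ (degree L u) (C2-gap {count S} {count D} S+D≡t)) ⟩
        degree L u + ((count S ∸ 1) C 2 + Y) + Δ  ≡⟨ cong (λ i → degree L u + (i + Y) + Δ) (through-count S u Su) ⟨
        degree L u + (I + Y) + Δ                  ≡⟨ reassoc (degree L u) I Y Δ ⟩
        degree L u + I + (Δ + Y)                  ∎)
        where
        open ≤-Reasoning
        Y = (count D + 1) * (t + 1)
        I = ∑<₃ (λ a b c → [ through u a b c ∧ inside S a b c ])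
        reassoc : ∀ g i y δ → g + (i + y) + δ ≡ g + i + (δ + y)
        reassoc = solve-∀
        cancel : ∀ {F I g T x B} → F + I + g ≡ T + x → T ≤ g + I + B → F ≤ B + x
        cancel {F} {I} {g} {T} {x} {B} split T≤ = +-cancelʳ-≤ (I + g) F (B + x) (begin
          F + (I + g)      ≡⟨ +-assoc F I g ⟨
          F + I + g        ≡⟨ split ⟩
          T + x            ≤⟨ +-monoˡ-≤ x T≤ ⟩
          g + I + B + x    ≡⟨ reassoc′ g I B x ⟩
          B + x + (I + g)  ∎)
          where
          reassoc′ : ∀ g i b x → g + i + b + x ≡ b + x + (i + g)
          reassoc′ = solve-∀

      ∑edgesInsideSThrough≤ : ∑[ u < n ] edgesInsideSThrough u ≤ 3 * edgesInside L S
      ∑edgesInsideSThrough≤ = begin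
        ∑[ u < n ] edgesInsideSThrough u                         ≡⟨ ∑<₃-∑ (λ u a b c → [ through u a b c ∧ q a b c ]) ⟨
        ∑<₃ (λ a b c → ∑[ u < n ] [ through u a b c ∧ q a b c ])  ≤⟨ ∑<₃-mono (λ a b c → ≤3 a b c (q a b c)) ⟩
        ∑<₃ (λ a b c → 3 * [ q a b c ])                          ≡⟨ ∑<₃-*ˡ 3 (λ a b c → [ q a b c ]) ⟩
        3 * edgesInside L S                                       ∎
        where
        open ≤-Reasoning
        q = λ a b c → inside S a b c ∧ L a b c
        ≤3 : ∀ a b c x → ∑[ u < n ] [ through u a b c ∧ x ] ≤ 3 * [ x ]
        ≤3 a b c x = begin
          ∑[ u < n ] [ through u a b c ∧ x ]      ≡⟨ sum-cong-≗ (λ u → [∧]≡[]*[] (through u a b c) x) ⟩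
          ∑[ u < n ] ([ through u a b c ] * [ x ]) ≡⟨ *-distribʳ-sum [ x ] (λ u → [ through u a b c ]) ⟨
          ∑[ u < n ] [ through u a b c ] * [ x ]   ≤⟨ *-monoˡ-≤ [ x ] (∑-through≤3 a b c) ⟩
          3 * [ x ]                               ∎

      copyMissing-≤ : ∀ Δ {t} → count S + count D ≡ t → (∀ u → (n ∸ 1) C 2 ≤ degree L u + t C 2 + Δ) →
                      copyMissing ≤ count S * (Δ + (count D + 1) * (t + 1)) + 3 * edgesInside L S + count D * ((n ∸ 1) C 2)
      copyMissing-≤ Δ {t} S+D≡t T≤ = begin
        copyMissing
          ≤⟨ copyMissing≤charges ⟩
        ∑[ u < n ] ([ S u ] * nonEdgesLeavingS u + [ D u ] * T)
          ≤⟨ sum-mono-≤ (λ u → +-monoˡ-≤ ([ D u ] * T) (leaving u (S u) refl)) ⟩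
        ∑[ u < n ] ([ S u ] * Z + edgesInsideSThrough u + [ D u ] * T)
          ≡⟨ ∑-distrib-+ (λ u → [ S u ] * Z + edgesInsideSThrough u) (λ u → [ D u ] * T) ⟩
        ∑[ u < n ] ([ S u ] * Z + edgesInsideSThrough u) + ∑[ u < n ] ([ D u ] * T)
          ≡⟨ cong₂ _+_ (trans (∑-distrib-+ (λ u → [ S u ] * Z) edgesInsideSThrough)
                              (cong (_+ _) (∑[]*≡count* S Z)))
                       (∑[]*≡count* D T) ⟩
        count S * Z + ∑[ u < n ] edgesInsideSThrough u + count D * T
          ≤⟨ +-monoˡ-≤ (count D * T) (+-monoʳ-≤ (count S * Z) ∑edgesInsideSThrough≤) ⟩
        count S * Z + 3 * edgesInside L S + count D * T ∎
        where
        open ≤-Reasoning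
        T = (n ∸ 1) C 2
        Z = Δ + (count D + 1) * (t + 1)
        leaving : ∀ u s → S u ≡ s → [ s ] * nonEdgesLeavingS u ≤ [ s ] * Z + edgesInsideSThrough u
        leaving u false _  = z≤n
        leaving u true  Su = begin
          1 * nonEdgesLeavingS u                ≡⟨ *-identityˡ _ ⟩
          nonEdgesLeavingS u                    ≤⟨ nonEdgesLeavingS-≤ Δ u S+D≡t (T≤ u) Su ⟩
          Z + edgesInsideSThrough u             ≡⟨ cong (_+ edgesInsideSThrough u) (*-identityˡ Z) ⟨
          1 * Z + edgesInsideSThrough u         ∎

  module _ {m : ℕ} (H : Graph13 m) where

    deg≡degree : ∀ v u → deg H v u ≡ degree (H v) u
    deg≡degree v u = begin
      deg H v u
        ≡⟨ countEdges≡∑∑<₃ (λ v′ a b c → ⌊ v′ ≟ v ⌋ ∧ X v′ a b c) ⟩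
      ∑[ v′ < m ] ∑<₃ (λ a b c → [ ⌊ v′ ≟ v ⌋ ∧ X v′ a b c ])
        ≡⟨ sum-cong-≗ (λ v′ → trans (∑<₃-[∧] ⌊ v′ ≟ v ⌋ (X v′))
                                    (cong (λ t → [ t ] * ∑<₃ (λ a b c → [ X v′ a b c ])) (⌊≟⌋≡≡ᵇ v′ v))) ⟩
      ∑[ v′ < m ] ([ v′ ≡ᵇ v ] * ∑<₃ (λ a b c → [ X v′ a b c ]))
        ≡⟨ ∑-δ v (λ v′ → ∑<₃ (λ a b c → [ X v′ a b c ])) ⟩
      ∑<₃ (λ a b c → [ X v a b c ])
        ≡⟨ ∑<₃-cong (λ a b c → cong (λ t → [ t ∧ H v a b c ]) (⌊≟⌋-through a b c)) ⟩
      degree (H v) u ∎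
      where
      open ≡-Reasoning
      X = λ v′ a b c → (⌊ a ≟ u ⌋ ∨ ⌊ b ≟ u ⌋ ∨ ⌊ c ≟ u ⌋) ∧ H v′ a b c
      ⌊≟⌋-through : ∀ a b c → (⌊ a ≟ u ⌋ ∨ ⌊ b ≟ u ⌋ ∨ ⌊ c ≟ u ⌋) ≡ through u a b c
      ⌊≟⌋-through a b c rewrite ⌊≟⌋≡≡ᵇ a u | ⌊≟⌋≡≡ᵇ b u | ⌊≟⌋≡≡ᵇ c u = refl

    e≤ : e H ≤ m * (3 * m * (3 * m * (3 * m)))
    e≤ = begin
      e H                                      ≡⟨ countEdges≡∑∑<₃ H ⟩
      ∑[ v < m ] ∑<₃ (λ a b c → [ H v a b c ])  ≤⟨ sum-mono-≤ (λ v → ∑<₃-bound _ λ a b c → []≤1 (H v a b c)) ⟩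
      ∑[ v < m ] (3 * m * (3 * m * (3 * m)))    ≡⟨ sum-const m _ ⟩
      m * (3 * m * (3 * m * (3 * m)))          ∎
      where open ≤-Reasoning

  module MissingCopyEdges {m : ℕ} (H : Graph13 m) (W AP : Subset (3 * m)) (AQ : Subset m) where

    open Copy (lookup W) (lookup AP)

    N N³ : ℕ
    N = 3 * m
    N³ = N * (N * N)

    Δ : ℕ
    Δ = maxᶠ λ v → maxᶠ λ u → (N ∸ 1) C 2 ∸ (deg H v u + (2 * m) C 2)

    K : ℕ
    K = count S * (Δ + (count D + 1) * (2 * m + 1)) + count D * ((N ∸ 1) C 2)

    degree-deficit : ∀ v u → (N ∸ 1) C 2 ≤ degree (H v) u + (2 * m) C 2 + Δ
    degree-deficit v u = begin
      (N ∸ 1) C 2                                     ≤⟨ m≤n+m∸n ((N ∸ 1) C 2) (d + (2 * m) C 2) ⟩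
      d + (2 * m) C 2 + ((N ∸ 1) C 2 ∸ (d + (2 * m) C 2))
                                                      ≤⟨ +-monoʳ-≤ (d + (2 * m) C 2) (≤-trans (≤-maxᶠ _ u) (≤-maxᶠ _ v)) ⟩
      d + (2 * m) C 2 + Δ                             ≡⟨ cong (λ x → x + (2 * m) C 2 + Δ) (deg≡degree H v u) ⟩
      degree (H v) u + (2 * m) C 2 + Δ                ∎
      where
      open ≤-Reasoning
      d = deg H v u

    count-S+D : ∣ W ∣ ≡ m → count S + count D ≡ 2 * m
    count-S+D ∣W∣≡m = +-cancelʳ-≡ m _ _ (begin
      count S + count D + m            ≡⟨ cong (count S + count D +_) (trans (sym ∣W∣≡m) (∣s∣≡count W)) ⟩
      count S + count D + count (lookup W) ≡⟨ count-partition ⟩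
      3 * m                            ≡⟨ 3m≡2m+m m ⟩
      2 * m + m                        ∎)
      where
      open ≡-Reasoning
      3m≡2m+m : ∀ m → 3 * m ≡ 2 * m + m
      3m≡2m+m = solve-∀

    copyMissing-≤-K : ∣ W ∣ ≡ m → ∀ v → copyMissing (H v) ≤ K + 3 * edgesInside (H v) S
    copyMissing-≤-K ∣W∣≡m v = begin
      copyMissing (H v)
        ≤⟨ copyMissing-≤ (H v) Δ (count-S+D ∣W∣≡m) (degree-deficit v) ⟩
      count S * Z + 3 * edgesInside (H v) S + count D * ((N ∸ 1) C 2)
        ≡⟨ rearrange (count S * Z) (3 * edgesInside (H v) S) (count D * ((N ∸ 1) C 2)) ⟩
      K + 3 * edgesInside (H v) S ∎
      where
      open ≤-Reasoning
      Z = Δ + (count D + 1) * (2 * m + 1)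
      rearrange : ∀ x e y → x + e + y ≡ x + y + e
      rearrange = solve-∀

    restricted-≤ : ∑[ v < m ] ([ lookup AQ v ] * edgesInside (H v) S) ≤ eInduced H AQ AP
    restricted-≤ = begin
      ∑[ v < m ] ([ lookup AQ v ] * edgesInside (H v) S)
        ≡⟨ sum-cong-≗ (λ v → ∑<₃-*ˡ [ lookup AQ v ] (λ a b c → [ inside S a b c ∧ H v a b c ])) ⟨
      ∑[ v < m ] ∑<₃ (λ a b c → [ lookup AQ v ] * [ inside S a b c ∧ H v a b c ])
        ≤⟨ sum-mono-≤ (λ v → ∑<₃-mono λ a b c →
             restrict (lookup AQ v) (lookup W a) (lookup AP a) (lookup W b) (lookup AP b)
                      (lookup W c) (lookup AP c) (H v a b c)) ⟩
      ∑[ v < m ] ∑<₃ (λ a b c → [ lookup AQ v ∧ lookup AP a ∧ lookup AP b ∧ lookup AP c ∧ H v a b c ])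
        ≡⟨ countEdges≡∑∑<₃ (λ v a b c → lookup AQ v ∧ lookup AP a ∧ lookup AP b ∧ lookup AP c ∧ H v a b c) ⟨
      eInduced H AQ AP ∎
      where
      open ≤-Reasoning
      restrict : ∀ q wa pa wb pb wc pc h →
                 [ q ] * [ ((not wa ∧ pa) ∧ (not wb ∧ pb) ∧ (not wc ∧ pc)) ∧ h ] ≤ [ q ∧ pa ∧ pb ∧ pc ∧ h ]
      restrict false _     _     _     _     _     _     _ = z≤n
      restrict true  true  _     _     _     _     _     _ = z≤n
      restrict true  false false _     _     _     _     _ = z≤n
      restrict true  false true  true  _     _     _     _ = z≤n
      restrict true  false true  false false _     _     _ = z≤n
      restrict true  false true  false true  true  _     _ = z≤n
      restrict true  false true  false true  false false _ = z≤n
      restrict true  false true  false true  false true  h = ≤-reflexive (+-identityʳ [ h ])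

    missing-≤ : ∣ W ∣ ≡ m →
                missing (H13copy W) H ≤ count (not ∘ lookup AQ) * N³ + ∣ AQ ∣ * K + 3 * eInduced H AQ AP
    missing-≤ ∣W∣≡m = begin
      missing (H13copy W) H
        ≡⟨ countEdges≡∑∑<₃ (λ v a b c → H13copy W v a b c ∧ not (H v a b c)) ⟩
      ∑[ v < m ] copyMissing (H v)
        ≤⟨ sum-mono-≤ (λ v → select (lookup AQ v) (∑<₃-bound _ (λ a b c → []≤1 _)) (copyMissing-≤-K ∣W∣≡m v)) ⟩
      ∑[ v < m ] ([ not (lookup AQ v) ] * N³ + [ lookup AQ v ] * (K + 3 * eᵥ v))
        ≡⟨ sum-cong-≗ (λ v → distribute [ not (lookup AQ v) ] N³ [ lookup AQ v ] K (eᵥ v)) ⟩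
      ∑[ v < m ] ([ not (lookup AQ v) ] * N³ + [ lookup AQ v ] * K + 3 * ([ lookup AQ v ] * eᵥ v))
        ≡⟨ trans (∑-distrib-+ (λ v → [ not (lookup AQ v) ] * N³ + [ lookup AQ v ] * K) _)
                 (cong₂ _+_ (trans (∑-distrib-+ (λ v → [ not (lookup AQ v) ] * N³) _)
                                   (cong₂ _+_ (∑[]*≡count* (not ∘ lookup AQ) N³)
                                              (trans (∑[]*≡count* (lookup AQ) K) (cong (_* K) (sym (∣s∣≡count AQ))))))
                            (sym (*-distribˡ-sum 3 (λ v → [ lookup AQ v ] * eᵥ v)))) ⟩
      count (not ∘ lookup AQ) * N³ + ∣ AQ ∣ * K + 3 * ∑[ v < m ] ([ lookup AQ v ] * eᵥ v)
        ≤⟨ +-monoʳ-≤ (count (not ∘ lookup AQ) * N³ + ∣ AQ ∣ * K) (*-monoʳ-≤ 3 restricted-≤) ⟩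
      count (not ∘ lookup AQ) * N³ + ∣ AQ ∣ * K + 3 * eInduced H AQ AP ∎
      where
      open ≤-Reasoning
      eᵥ : Fin m → ℕ
      eᵥ v = edgesInside (H v) S
      select : ∀ q {x y z} → x ≤ y → x ≤ z → x ≤ [ not q ] * y + [ q ] * z
      select false {y = y} x≤y _   = ≤-trans x≤y (≤-reflexive (sym (trans (+-identityʳ _) (*-identityˡ y))))
      select true  {z = z} _   x≤z = ≤-trans x≤z (≤-reflexive (sym (*-identityˡ z)))
      distribute : ∀ p y q k e → p * y + q * (k + 3 * e) ≡ p * y + q * k + 3 * (q * e)
      distribute = solve-∀

  -- Choosing W

  takeFirst : ∀ {n} → ℕ → Subset n → Subset n
  takeFirst j       []          = []
  takeFirst j       (false ∷ s) = false ∷ takeFirst j s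
  takeFirst zero    (true ∷ s)  = false ∷ takeFirst zero s
  takeFirst (suc j) (true ∷ s)  = true ∷ takeFirst j s

  takeFirst-⊆ : ∀ {n} j (s : Subset n) i → lookup (takeFirst j s) i ≡ true → lookup s i ≡ true
  takeFirst-⊆ j       (false ∷ s) (suc i) = takeFirst-⊆ j s i
  takeFirst-⊆ zero    (true ∷ s)  (suc i) = takeFirst-⊆ zero s i
  takeFirst-⊆ (suc j) (true ∷ s)  zero    = λ _ → refl
  takeFirst-⊆ (suc j) (true ∷ s)  (suc i) = takeFirst-⊆ j s i

  ∣takeFirst∣ : ∀ {n} j (s : Subset n) → ∣ takeFirst j s ∣ ≡ j ⊓ ∣ s ∣
  ∣takeFirst∣ j       []          = sym (⊓-zeroʳ j)
  ∣takeFirst∣ j       (false ∷ s) = ∣takeFirst∣ j s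
  ∣takeFirst∣ zero    (true ∷ s)  = ∣takeFirst∣ zero s
  ∣takeFirst∣ (suc j) (true ∷ s)  = cong suc (∣takeFirst∣ j s)

  ∣∁s∣≡count : ∀ {n} (s : Subset n) → ∣ ∁ s ∣ ≡ count (not ∘ lookup s)
  ∣∁s∣≡count s = trans (∣s∣≡count (∁ s)) (sum-cong-≗ λ i → cong [_] (lookup-map i not s))

  choose-W : ∀ {n} m (A : Subset n) → m ≤ n → Σ (Subset n) λ W → ∣ W ∣ ≡ m ×
             (count (Copy.D (lookup W) (lookup A)) ≡ 0 ⊎ count (Copy.S (lookup W) (lookup A)) ≡ ∣ A ∣)
  choose-W {n} m A m≤n with m ≤? ∣ ∁ A ∣
  ... | yes m≤∣∁A∣ = W , trans (∣takeFirst∣ m (∁ A)) (m≤n⇒m⊓n≡m m≤∣∁A∣) ,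
                     inj₂ (trans (sum-cong-≗ λ i → cong [_] (S≡A i)) (sym (∣s∣≡count A)))
    where
    W = takeFirst m (∁ A)
    S≡A : ∀ i → not (lookup W i) ∧ lookup A i ≡ lookup A i
    S≡A i with lookup A i in Ai | lookup W i in Wi
    ... | false | _     = ∧-zeroʳ _
    ... | true  | false = refl
    ... | true  | true  = case trans (sym (takeFirst-⊆ m (∁ A) i Wi)) (trans (lookup-map i not A) (cong not Ai)) of λ ()
  ... | no m≰∣∁A∣ = W , ∣W∣≡m , inj₁ (trans (sum-cong-≗ λ i → cong [_] (D≡false i)) (sum-replicate-zero n))
    where
    c = count (not ∘ lookup A)
    T = takeFirst (m ∸ c) A
    W = ∁ A ∪ T
    lookup-W : ∀ i → lookup W i ≡ not (lookup A i) ∨ lookup T i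
    lookup-W i = trans (lookup-zipWith _∨_ i (∁ A) T) (cong (_∨ lookup T i) (lookup-map i not A))
    D≡false : ∀ i → not (lookup W i) ∧ not (lookup A i) ≡ false
    D≡false i rewrite lookup-W i with lookup A i
    ... | true  = ∧-zeroʳ _
    ... | false = refl
    disjoint : ∀ i → [ lookup W i ] ≡ [ not (lookup A i) ] + [ lookup T i ]
    disjoint i rewrite lookup-W i with lookup A i in Ai | lookup T i in Ti
    ... | true  | _     = refl
    ... | false | false = refl
    ... | false | true  = case trans (sym (takeFirst-⊆ (m ∸ c) A i Ti)) Ai of λ ()
    c<m : c < m
    c<m = subst (_< m) (∣∁s∣≡count A) (≰⇒> m≰∣∁A∣)
    m∸c≤∣A∣ : m ∸ c ≤ ∣ A ∣
    m∸c≤∣A∣ = subst (m ∸ c ≤_) (trans (cong (_∸ c) (sym (count-∁ A))) (m+n∸m≡n c ∣ A ∣)) (∸-monoˡ-≤ c m≤n)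
    ∣W∣≡m : ∣ W ∣ ≡ m
    ∣W∣≡m = begin
      ∣ W ∣                    ≡⟨ ∣s∣≡count W ⟩
      count (lookup W)         ≡⟨ trans (sum-cong-≗ disjoint) (∑-distrib-+ (λ i → [ not (lookup A i) ]) _) ⟩
      c + count (lookup T)     ≡⟨ cong (c +_) (trans (sym (∣s∣≡count T))
                                                  (trans (∣takeFirst∣ (m ∸ c) A) (m≤n⇒m⊓n≡m m∸c≤∣A∣))) ⟩
      c + (m ∸ c)              ≡⟨ m+[n∸m]≡n (<⇒≤ c<m) ⟩
      m                        ∎
      where open ≡-Reasoning

module RationalEstimates where

  open import Defs
  open Counting using (maxᶠ; count; count-∁; ∣s∣≡count; C2≤square; module Copy; module MissingCopyEdges; e≤)
  open import Data.Nat.Combinatorics using (_C_)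
  open import Data.Fin.Subset using (Subset; ∣_∣)
  open import Data.Fin.Subset.Properties using (∣p∣≤n)
  open import Data.Vec using (lookup)
  open import Data.Bool using (not)
  open import Data.Fin using (Fin; zero; suc)
  open import Function using (_∘_)
  open import Data.Nat as ℕ using (ℕ; suc)
  import Data.Nat.Properties as ℕ
  open import Data.Integer as ℤ using (+_; +[1+_]; -[1+_])
  import Data.Integer.Properties as ℤ
  open import Data.Rational
    using (ℚ; mkℚ; *<*; 0ℚ; 1ℚ; _+_; _*_; _-_; _/_; _≤_; _<_; toℚᵘ; nonNegative; positive)
  open import Data.Rational.Properties
  import Data.Rational.Unnormalised as ℚᵘ
  import Data.Rational.Unnormalised.Properties as ℚᵘ
  open import Data.Rational.Solver using (module +-*-Solver)
  open import Data.Product using (Σ; _,_)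
  open import Data.Sum using (_⊎_; inj₁; inj₂)
  open import Data.Unit using (tt)
  open import Relation.Binary.PropositionalEquality
    using (_≡_; refl; sym; trans; cong; cong₂; subst; subst₂; module ≡-Reasoning)
  open import Relation.Nullary using (yes; no)
  open import Relation.Nullary.Decidable using (toWitness)
  open +-*-Solver

  toℚᵘ-ℕ→ℚ : ∀ n → toℚᵘ (ℕ→ℚ n) ℚᵘ.≃ ℚᵘ.mkℚᵘ (+ n) 0
  toℚᵘ-ℕ→ℚ n = toℚᵘ-fromℚᵘ (ℚᵘ.mkℚᵘ (+ n) 0)

  ℕ→ℚ-+ : ∀ a b → ℕ→ℚ (a ℕ.+ b) ≡ ℕ→ℚ a + ℕ→ℚ b
  ℕ→ℚ-+ a b = toℚᵘ-injective (ℚᵘ.≃-trans (toℚᵘ-ℕ→ℚ (a ℕ.+ b)) (ℚᵘ.≃-trans sum≃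
    (ℚᵘ.≃-sym (ℚᵘ.≃-trans (toℚᵘ-homo-+ (ℕ→ℚ a) (ℕ→ℚ b)) (ℚᵘ.+-cong (toℚᵘ-ℕ→ℚ a) (toℚᵘ-ℕ→ℚ b))))))
    where
    sum≃ : ℚᵘ.mkℚᵘ (+ (a ℕ.+ b)) 0 ℚᵘ.≃ ℚᵘ.mkℚᵘ (+ a) 0 ℚᵘ.+ ℚᵘ.mkℚᵘ (+ b) 0
    sum≃ = ℚᵘ.*≡* (trans (ℤ.*-identityʳ _) (trans (ℤ.pos-+ a b) (sym (trans (ℤ.*-identityʳ _)
             (cong₂ ℤ._+_ (ℤ.*-identityʳ (+ a)) (ℤ.*-identityʳ (+ b)))))))

  ℕ→ℚ-* : ∀ a b → ℕ→ℚ (a ℕ.* b) ≡ ℕ→ℚ a * ℕ→ℚ b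
  ℕ→ℚ-* a b = toℚᵘ-injective (ℚᵘ.≃-trans (toℚᵘ-ℕ→ℚ (a ℕ.* b)) (ℚᵘ.≃-trans product≃
    (ℚᵘ.≃-sym (ℚᵘ.≃-trans (toℚᵘ-homo-* (ℕ→ℚ a) (ℕ→ℚ b)) (ℚᵘ.*-cong (toℚᵘ-ℕ→ℚ a) (toℚᵘ-ℕ→ℚ b))))))
    where
    product≃ : ℚᵘ.mkℚᵘ (+ (a ℕ.* b)) 0 ℚᵘ.≃ ℚᵘ.mkℚᵘ (+ a) 0 ℚᵘ.* ℚᵘ.mkℚᵘ (+ b) 0
    product≃ = ℚᵘ.*≡* (trans (ℤ.*-identityʳ _) (trans (ℤ.pos-* a b) (sym (ℤ.*-identityʳ _))))

  ℕ→ℚ-mono-≤ : ∀ {a b} → a ℕ.≤ b → ℕ→ℚ a ≤ ℕ→ℚ b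
  ℕ→ℚ-mono-≤ {a} {b} a≤b = toℚᵘ-cancel-≤ (ℚᵘ.≤-respʳ-≃ (ℚᵘ.≃-sym (toℚᵘ-ℕ→ℚ b)) (ℚᵘ.≤-respˡ-≃ (ℚᵘ.≃-sym (toℚᵘ-ℕ→ℚ a))
    (ℚᵘ.*≤* (subst₂ ℤ._≤_ (sym (ℤ.*-identityʳ (+ a))) (sym (ℤ.*-identityʳ (+ b))) (ℤ.+≤+ a≤b)))))

  0≤ℕ→ℚ : ∀ n → 0ℚ ≤ ℕ→ℚ n
  0≤ℕ→ℚ n = ℕ→ℚ-mono-≤ {0} {n} ℕ.z≤n

  *-monoˡ-≤-0≤ : ∀ {r p q} → 0ℚ ≤ r → p ≤ q → r * p ≤ r * q
  *-monoˡ-≤-0≤ {r} 0≤r = *-monoˡ-≤-nonNeg r {{nonNegative 0≤r}}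

  *-monoʳ-≤-0≤ : ∀ {r p q} → 0ℚ ≤ r → p ≤ q → p * r ≤ q * r
  *-monoʳ-≤-0≤ {r} 0≤r = *-monoʳ-≤-nonNeg r {{nonNegative 0≤r}}

  0≤* : ∀ {p q} → 0ℚ ≤ p → 0ℚ ≤ q → 0ℚ ≤ p * q
  0≤* {p} 0≤p 0≤q = ≤-trans (≤-reflexive (sym (*-zeroʳ p))) (*-monoˡ-≤-0≤ 0≤p 0≤q)

  *-mono-≤-0≤ : ∀ {p q r s} → 0ℚ ≤ p → 0ℚ ≤ r → p ≤ q → r ≤ s → p * r ≤ q * s
  *-mono-≤-0≤ 0≤p 0≤r p≤q r≤s = ≤-trans (*-monoˡ-≤-0≤ 0≤p r≤s) (*-monoʳ-≤-0≤ (≤-trans 0≤r r≤s) p≤q)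

  0≤+ : ∀ {p q} → 0ℚ ≤ p → 0ℚ ≤ q → 0ℚ ≤ p + q
  0≤+ = +-mono-≤

  0<1 : 0ℚ < 1ℚ
  0<1 = toWitness {a? = 0ℚ <? 1ℚ} tt

  0≤1 : 0ℚ ≤ 1ℚ
  0≤1 = toWitness {a? = 0ℚ ≤? 1ℚ} tt

  module Estimate (ε X : ℚ) where

    N N² N³ β : ℚ
    N  = ℕ→ℚ 3 * X
    N² = N * N
    N³ = N * N²
    β  = (+ 3 / 8) * (ε * X)

    estimate : ∀ {B A K D Δ C E} → 0ℚ ≤ ε → 1ℚ ≤ X → 1ℚ ≤ ε * X → 0ℚ ≤ A → 0ℚ ≤ K → 0ℚ ≤ D → 0ℚ ≤ Δ → 0ℚ ≤ C →
               B ≤ β → A ≤ X → K ≤ ℕ→ℚ 2 * X → D ≤ β → Δ ≤ ε * (+ 1 / 4) * N² → C ≤ N² → E ≤ ε * (+ 1 / 6) * (X * N³) →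
               B * N³ + A * (K * (Δ + (D + 1ℚ) * (ℕ→ℚ 2 * X + 1ℚ)) + D * C) + ℕ→ℚ 3 * E
                 < ε * (ℕ→ℚ 4 * X * (ℕ→ℚ 4 * X) * (ℕ→ℚ 4 * X) * (ℕ→ℚ 4 * X))
    estimate {B} {A} {K} {D} {Δ} {C} {E} 0≤ε 1≤X 1≤εX 0≤A 0≤K 0≤D 0≤Δ 0≤C B≤β A≤X K≤2X D≤β Δ≤ C≤N² E≤ = begin-strict
      B * N³ + A * (K * (Δ + (D + 1ℚ) * Q) + D * C) + ℕ→ℚ 3 * E
        ≤⟨ +-mono-≤ (+-mono-≤ (*-monoʳ-≤-0≤ 0≤N³ B≤β) A-term≤) (*-monoˡ-≤-0≤ (0≤ℕ→ℚ 3) E≤) ⟩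
      β * N³ + X * (ℕ→ℚ 2 * X * (ε * (+ 1 / 4) * N² + (β + ε * X) * N) + β * N²) + ℕ→ℚ 3 * (ε * (+ 1 / 6) * (X * N³))
        -- 159/4 = 81/8 + 9/2 + 33/4 + 27/8 + 27/2, one summand per term.
        ≡⟨ solve 2 (λ e x → expanded e x := con (+ 159 / 4) :* (e :* (x :* (x :* (x :* x))))) refl ε X ⟩
      (+ 159 / 4) * (ε * X⁴)
        <⟨ *-monoˡ-<-pos (ε * X⁴) {{positive 0<εX⁴}} (toWitness {a? = (+ 159 / 4) <? (+ 256 / 1)} tt) ⟩
      (+ 256 / 1) * (ε * X⁴)
        ≡⟨ solve 2 (λ e x → con (+ 256 / 1) :* (e :* (x :* (x :* (x :* x))))
                           := e :* (four x :* four x :* four x :* four x)) refl ε X ⟩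
      ε * (ℕ→ℚ 4 * X * (ℕ→ℚ 4 * X) * (ℕ→ℚ 4 * X) * (ℕ→ℚ 4 * X)) ∎
      where
      open ≤-Reasoning
      Q = ℕ→ℚ 2 * X + 1ℚ
      X⁴ = X * (X * (X * X))
      0≤X : 0ℚ ≤ X
      0≤X = ≤-trans 0≤1 1≤X
      0≤N : 0ℚ ≤ N
      0≤N = 0≤* (0≤ℕ→ℚ 3) 0≤X
      0≤N³ : 0ℚ ≤ N³
      0≤N³ = 0≤* 0≤N (0≤* 0≤N 0≤N)
      0≤Q : 0ℚ ≤ Q
      0≤Q = 0≤+ (0≤* (0≤ℕ→ℚ 2) 0≤X) 0≤1
      Q≤N : Q ≤ N
      Q≤N = ≤-trans (+-monoʳ-≤ (ℕ→ℚ 2 * X) 1≤X)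
                    (≤-reflexive (solve 1 (λ x → con (ℕ→ℚ 2) :* x :+ x := con (ℕ→ℚ 3) :* x) refl X))
      0≤Z : 0ℚ ≤ Δ + (D + 1ℚ) * Q
      0≤Z = 0≤+ 0≤Δ (0≤* (0≤+ 0≤D 0≤1) 0≤Q)
      Z≤ : Δ + (D + 1ℚ) * Q ≤ ε * (+ 1 / 4) * N² + (β + ε * X) * N
      Z≤ = +-mono-≤ Δ≤ (*-mono-≤-0≤ (0≤+ 0≤D 0≤1) 0≤Q (+-mono-≤ D≤β 1≤εX) Q≤N)
      A-term≤ : A * (K * (Δ + (D + 1ℚ) * Q) + D * C) ≤ X * (ℕ→ℚ 2 * X * (ε * (+ 1 / 4) * N² + (β + ε * X) * N) + β * N²)
      A-term≤ = *-mono-≤-0≤ 0≤A (0≤+ (0≤* 0≤K 0≤Z) (0≤* 0≤D 0≤C)) A≤X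
                  (+-mono-≤ (*-mono-≤-0≤ 0≤K 0≤Z K≤2X Z≤) (*-mono-≤-0≤ 0≤D 0≤C D≤β C≤N²))
      0<εX⁴ : 0ℚ < ε * X⁴
      0<εX⁴ = <-≤-trans 0<1 (begin
        1ℚ                     ≤⟨ *-mono-≤-0≤ 0≤1 0≤1 1≤εX (*-mono-≤-0≤ 0≤1 0≤1 1≤X (*-mono-≤-0≤ 0≤1 0≤1 1≤X 1≤X)) ⟩
        ε * X * (X * (X * X))  ≡⟨ *-assoc ε X (X * (X * X)) ⟩
        ε * X⁴                 ∎)
      four : Polynomial 2 → Polynomial 2
      four x = con (ℕ→ℚ 4) :* x
      expanded : Polynomial 2 → Polynomial 2 → Polynomial 2
      expanded e x = b :* n³ :+ x :* (con (ℕ→ℚ 2) :* x :* (e :* con (+ 1 / 4) :* n² :+ (b :+ e :* x) :* n) :+ b :* n²)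
                     :+ con (ℕ→ℚ 3) :* (e :* con (+ 1 / 6) :* (x :* n³))
        where
        n = con (ℕ→ℚ 3) :* x
        n² = n :* n
        n³ = n :* n²
        b = con (+ 3 / 8) :* (e :* x)

  archimedean : ∀ ε → 0ℚ < ε → Σ ℕ λ k → 1ℚ ≤ ε * ℕ→ℚ (suc k)
  archimedean (mkℚ (+ 0)    _ _) (*<* (ℤ.+<+ ()))
  archimedean (mkℚ -[1+ _ ] _ _) (*<* ())
  -- ε = (k+1)/(d+1), so ε (d+1) = k+1 ≥ 1.
  archimedean ε@(mkℚ +[1+ k ] d _) _ = d , toℚᵘ-cancel-≤ (ℚᵘ.≤-respˡ-≃ (ℚᵘ.≃-sym (toℚᵘ-ℕ→ℚ 1))
    (ℚᵘ.≤-respʳ-≃ (ℚᵘ.≃-sym (ℚᵘ.≃-trans (toℚᵘ-homo-* ε (ℕ→ℚ (suc d))) (ℚᵘ.*-cong (ℚᵘ.≃-refl {toℚᵘ ε}) (toℚᵘ-ℕ→ℚ (suc d)))))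
      (ℚᵘ.*≤* (subst₂ ℤ._≤_ (sym (ℤ.*-identityˡ _)) (trans (ℤ.pos-* (suc k) (suc d)) (sym (ℤ.*-identityʳ _)))
        (ℤ.+≤+ (ℕ.≤-trans (ℕ.≤-reflexive (ℕ.*-identityʳ (suc d))) (ℕ.m≤n*m (suc d) (suc k))))))))

  ℕ→ℚ-∸-≤ : ∀ x y {r} → 0ℚ ≤ r → ℕ→ℚ x - ℕ→ℚ y ≤ r → ℕ→ℚ (x ℕ.∸ y) ≤ r
  ℕ→ℚ-∸-≤ x y 0≤r x-y≤r with y ℕ.≤? x
  ... | yes y≤x = ≤-trans (≤-reflexive x∸y≡x-y) x-y≤r
    where
    x∸y≡x-y : ℕ→ℚ (x ℕ.∸ y) ≡ ℕ→ℚ x - ℕ→ℚ y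
    x∸y≡x-y = trans (solve 2 (λ a b → a := a :+ b :- b) refl (ℕ→ℚ (x ℕ.∸ y)) (ℕ→ℚ y))
                    (cong (_- ℕ→ℚ y) (trans (sym (ℕ→ℚ-+ (x ℕ.∸ y) y)) (cong ℕ→ℚ (ℕ.m∸n+n≡m y≤x))))
  ... | no  y≰x = ≤-trans (≤-reflexive (cong ℕ→ℚ (ℕ.m≤n⇒m∸n≡0 (ℕ.<⇒≤ (ℕ.≰⇒> y≰x))))) 0≤r

  ℕ→ℚ-maxᶠ-≤ : ∀ {k} (f : Fin k → ℕ) {r} → 0ℚ ≤ r → (∀ i → ℕ→ℚ (f i) ≤ r) → ℕ→ℚ (maxᶠ f) ≤ r
  ℕ→ℚ-maxᶠ-≤ {ℕ.zero} f 0≤r _ = 0≤r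
  ℕ→ℚ-maxᶠ-≤ {suc k}  f 0≤r f≤r with ℕ.⊔-sel (f zero) (maxᶠ (f ∘ suc))
  ... | inj₁ max≡f₀ = subst (λ x → ℕ→ℚ x ≤ _) (sym max≡f₀) (f≤r zero)
  ... | inj₂ max≡fₛ = subst (λ x → ℕ→ℚ x ≤ _) (sym max≡fₛ) (ℕ→ℚ-maxᶠ-≤ (f ∘ suc) 0≤r (f≤r ∘ suc))

  ≤-of-+≡ : ∀ {x y t r} → x + y ≡ t → t - r ≤ y → x ≤ r
  ≤-of-+≡ {x} {y} {t} {r} x+y≡t t-r≤y = begin
    x                 ≡⟨ solve 2 (λ x y → x := x :+ y :- y) refl x y ⟩
    x + y - y         ≡⟨ cong (_- y) x+y≡t ⟩
    t - y             ≤⟨ +-monoʳ-≤ t (neg-antimono-≤ t-r≤y) ⟩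
    t - (t - r)       ≡⟨ solve 2 (λ t r → t :- (t :- r) := r) refl t r ⟩
    r                 ∎
    where open ≤-Reasoning

  0<ε-of-ρ : ∀ {ε ρ} → 0ℚ < ρ → ρ ≤ ε * (+ 1 / 4) → 0ℚ < ε
  0<ε-of-ρ {ε} 0<ρ ρ≤ε/4 = ≰⇒> λ ε≤0 → <-irrefl refl (<-≤-trans 0<ρ (≤-trans ρ≤ε/4
    (≤-trans (*-monoʳ-≤-0≤ (toWitness {a? = 0ℚ ≤? (+ 1 / 4)} tt) ε≤0) (≤-reflexive (*-zeroˡ (+ 1 / 4))))))

  module Closeness {m : ℕ} (H : Graph13 m) (W AP : Subset (3 ℕ.* m)) (AQ : Subset m) where

    open MissingCopyEdges H W AP AQ
    open Copy (lookup W) (lookup AP)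

    X : ℚ
    X = ℕ→ℚ m

    ℕ→ℚ-N : ℕ→ℚ N ≡ ℕ→ℚ 3 * X
    ℕ→ℚ-N = ℕ→ℚ-* 3 m

    ℕ→ℚ-N² : ℕ→ℚ (N ℕ.* N) ≡ ℕ→ℚ 3 * X * (ℕ→ℚ 3 * X)
    ℕ→ℚ-N² = trans (ℕ→ℚ-* N N) (cong₂ _*_ ℕ→ℚ-N ℕ→ℚ-N)

    ℕ→ℚ-N³ : ℕ→ℚ N³ ≡ ℕ→ℚ 3 * X * (ℕ→ℚ 3 * X * (ℕ→ℚ 3 * X))
    ℕ→ℚ-N³ = trans (ℕ→ℚ-* N (N ℕ.* N)) (cong₂ _*_ ℕ→ℚ-N ℕ→ℚ-N²)

    b a k d δ c E : ℚ
    b = ℕ→ℚ (count (not ∘ lookup AQ))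
    a = ℕ→ℚ ∣ AQ ∣
    k = ℕ→ℚ (count S)
    d = ℕ→ℚ (count D)
    δ = ℕ→ℚ Δ
    c = ℕ→ℚ ((N ℕ.∸ 1) C 2)
    E = ℕ→ℚ (eInduced H AQ AP)

    ℕ→ℚ-K : ℕ→ℚ K ≡ k * (δ + (d + 1ℚ) * (ℕ→ℚ 2 * X + 1ℚ)) + d * c
    ℕ→ℚ-K = begin
      ℕ→ℚ (kₙ ℕ.* (Δ ℕ.+ (dₙ ℕ.+ 1) ℕ.* (2 ℕ.* m ℕ.+ 1)) ℕ.+ dₙ ℕ.* cₙ)
        ≡⟨ ℕ→ℚ-+ (kₙ ℕ.* (Δ ℕ.+ (dₙ ℕ.+ 1) ℕ.* (2 ℕ.* m ℕ.+ 1))) (dₙ ℕ.* cₙ) ⟩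
      ℕ→ℚ (kₙ ℕ.* (Δ ℕ.+ (dₙ ℕ.+ 1) ℕ.* (2 ℕ.* m ℕ.+ 1))) + ℕ→ℚ (dₙ ℕ.* cₙ)
        ≡⟨ cong₂ _+_ (trans (ℕ→ℚ-* kₙ (Δ ℕ.+ (dₙ ℕ.+ 1) ℕ.* (2 ℕ.* m ℕ.+ 1))) (cong (k *_) ℕ→ℚ-Z)) (ℕ→ℚ-* dₙ cₙ) ⟩
      k * (δ + (d + 1ℚ) * (ℕ→ℚ 2 * X + 1ℚ)) + d * c ∎
      where
      open ≡-Reasoning
      kₙ = count S
      dₙ = count D
      cₙ = (N ℕ.∸ 1) C 2
      ℕ→ℚ-Z : ℕ→ℚ (Δ ℕ.+ (dₙ ℕ.+ 1) ℕ.* (2 ℕ.* m ℕ.+ 1)) ≡ δ + (d + 1ℚ) * (ℕ→ℚ 2 * X + 1ℚ)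
      ℕ→ℚ-Z = trans (ℕ→ℚ-+ Δ ((dₙ ℕ.+ 1) ℕ.* (2 ℕ.* m ℕ.+ 1))) (cong (_+_ δ)
        (trans (ℕ→ℚ-* (dₙ ℕ.+ 1) (2 ℕ.* m ℕ.+ 1))
               (cong₂ _*_ (ℕ→ℚ-+ dₙ 1) (trans (ℕ→ℚ-+ (2 ℕ.* m) 1) (cong (_+ 1ℚ) (ℕ→ℚ-* 2 m))))))

    ℕ→ℚ-missing-bound :
      ℕ→ℚ (count (not ∘ lookup AQ) ℕ.* N³ ℕ.+ ∣ AQ ∣ ℕ.* K ℕ.+ 3 ℕ.* eInduced H AQ AP)
        ≡ b * (ℕ→ℚ 3 * X * (ℕ→ℚ 3 * X * (ℕ→ℚ 3 * X))) + a * (k * (δ + (d + 1ℚ) * (ℕ→ℚ 2 * X + 1ℚ)) + d * c) + ℕ→ℚ 3 * E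
    ℕ→ℚ-missing-bound = begin
      ℕ→ℚ (bₙ ℕ.* N³ ℕ.+ ∣ AQ ∣ ℕ.* K ℕ.+ 3 ℕ.* eₙ)
        ≡⟨ ℕ→ℚ-+ (bₙ ℕ.* N³ ℕ.+ ∣ AQ ∣ ℕ.* K) (3 ℕ.* eₙ) ⟩
      ℕ→ℚ (bₙ ℕ.* N³ ℕ.+ ∣ AQ ∣ ℕ.* K) + ℕ→ℚ (3 ℕ.* eₙ)
        ≡⟨ cong (_+ ℕ→ℚ (3 ℕ.* eₙ)) (ℕ→ℚ-+ (bₙ ℕ.* N³) (∣ AQ ∣ ℕ.* K)) ⟩
      ℕ→ℚ (bₙ ℕ.* N³) + ℕ→ℚ (∣ AQ ∣ ℕ.* K) + ℕ→ℚ (3 ℕ.* eₙ)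
        ≡⟨ cong₂ _+_ (cong₂ _+_ (trans (ℕ→ℚ-* bₙ N³) (cong (b *_) ℕ→ℚ-N³))
                                (trans (ℕ→ℚ-* ∣ AQ ∣ K) (cong (a *_) ℕ→ℚ-K)))
                     (ℕ→ℚ-* 3 eₙ) ⟩
      b * (ℕ→ℚ 3 * X * (ℕ→ℚ 3 * X * (ℕ→ℚ 3 * X))) + a * (k * (δ + (d + 1ℚ) * (ℕ→ℚ 2 * X + 1ℚ)) + d * c) + ℕ→ℚ 3 * E ∎
      where
      open ≡-Reasoning
      bₙ = count (not ∘ lookup AQ)
      eₙ = eInduced H AQ AP

    module _ {ε : ℚ} (0≤ε : 0ℚ ≤ ε) (1≤X : 1ℚ ≤ X) where

      open Estimate ε X using (β)

      0≤X : 0ℚ ≤ X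
      0≤X = ≤-trans 0≤1 1≤X

      0≤β : 0ℚ ≤ β
      0≤β = 0≤* (toWitness {a? = 0ℚ ≤? (+ 3 / 8)} tt) (0≤* 0≤ε 0≤X)

      b≤β : ((+ 1 / 3) - ε * (+ 1 / 8)) * ℕ→ℚ (3 ℕ.* m) ≤ a → b ≤ β
      b≤β a≥ = ≤-of-+≡ b+a≡X (≤-trans (≤-reflexive X-β≡) a≥)
        where
        b+a≡X : b + a ≡ X
        b+a≡X = trans (sym (ℕ→ℚ-+ (count (not ∘ lookup AQ)) ∣ AQ ∣)) (cong ℕ→ℚ (count-∁ AQ))
        X-β≡ : X - β ≡ ((+ 1 / 3) - ε * (+ 1 / 8)) * ℕ→ℚ (3 ℕ.* m)
        X-β≡ = trans (solve 2 (λ e x → x :- con (+ 3 / 8) :* (e :* x)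
                                        := (con (+ 1 / 3) :- e :* con (+ 1 / 8)) :* (con (ℕ→ℚ 3) :* x)) refl ε X)
                     (cong (((+ 1 / 3) - ε * (+ 1 / 8)) *_) (sym ℕ→ℚ-N))

      d≤β : ∣ W ∣ ≡ m → count D ≡ 0 ⊎ count S ≡ ∣ AP ∣ →
            ((+ 2 / 3) - ε * (+ 1 / 8)) * ℕ→ℚ (3 ℕ.* m) ≤ ℕ→ℚ ∣ AP ∣ → d ≤ β
      d≤β _     (inj₁ D≡0) _  = subst (λ x → ℕ→ℚ x ≤ β) (sym D≡0) 0≤β
      d≤β ∣W∣≡m (inj₂ S≡AP) k≥ = ≤-of-+≡ d+k≡2X (≤-trans (≤-reflexive 2X-β≡) (subst (λ x → _ ≤ ℕ→ℚ x) (sym S≡AP) k≥))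
        where
        d+k≡2X : d + k ≡ ℕ→ℚ 2 * X
        d+k≡2X = trans (sym (ℕ→ℚ-+ (count D) (count S)))
                       (trans (cong ℕ→ℚ (trans (ℕ.+-comm (count D) (count S)) (count-S+D ∣W∣≡m))) (ℕ→ℚ-* 2 m))
        2X-β≡ : ℕ→ℚ 2 * X - β ≡ ((+ 2 / 3) - ε * (+ 1 / 8)) * ℕ→ℚ (3 ℕ.* m)
        2X-β≡ = trans (solve 2 (λ e x → con (ℕ→ℚ 2) :* x :- con (+ 3 / 8) :* (e :* x)
                                          := (con (+ 2 / 3) :- e :* con (+ 1 / 8)) :* (con (ℕ→ℚ 3) :* x)) refl ε X)
                      (cong (((+ 2 / 3) - ε * (+ 1 / 8)) *_) (sym ℕ→ℚ-N))

    δ≤ : ∀ {ε ρ} → 0ℚ ≤ ρ → ρ ≤ ε * (+ 1 / 4) →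
         (∀ v u → ℕ→ℚ ((N ℕ.∸ 1) C 2) - ℕ→ℚ ((2 ℕ.* m) C 2) - ρ * ℕ→ℚ (N ℕ.^ 2) ≤ ℕ→ℚ (deg H v u)) →
         δ ≤ ε * (+ 1 / 4) * (ℕ→ℚ 3 * X * (ℕ→ℚ 3 * X))
    δ≤ {ε} {ρ} 0≤ρ ρ≤ε/4 deg≥ = ≤-trans (ℕ→ℚ-maxᶠ-≤ _ 0≤r λ v → ℕ→ℚ-maxᶠ-≤ _ 0≤r λ u → deficit≤ v u) r≤
      where
      r = ρ * ℕ→ℚ (N ℕ.^ 2)
      0≤r : 0ℚ ≤ r
      0≤r = 0≤* 0≤ρ (0≤ℕ→ℚ (N ℕ.^ 2))
      deficit≤ : ∀ v u → ℕ→ℚ ((N ℕ.∸ 1) C 2 ℕ.∸ (deg H v u ℕ.+ (2 ℕ.* m) C 2)) ≤ r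
      deficit≤ v u = ℕ→ℚ-∸-≤ ((N ℕ.∸ 1) C 2) (deg H v u ℕ.+ (2 ℕ.* m) C 2) 0≤r (begin
        t - ℕ→ℚ (deg H v u ℕ.+ (2 ℕ.* m) C 2)
          ≡⟨ cong (_-_ t) (ℕ→ℚ-+ (deg H v u) ((2 ℕ.* m) C 2)) ⟩
        t - (g + q)
          ≡⟨ solve 4 (λ t q r g → t :- (g :+ q) := (t :- q :- r) :+ (r :- g)) refl t q r g ⟩
        (t - q - r) + (r - g)
          ≤⟨ +-monoˡ-≤ (r - g) (deg≥ v u) ⟩
        g + (r - g)
          ≡⟨ solve 2 (λ g r → g :+ (r :- g) := r) refl g r ⟩
        r ∎)
        where
        open ≤-Reasoning
        t = ℕ→ℚ ((N ℕ.∸ 1) C 2)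
        q = ℕ→ℚ ((2 ℕ.* m) C 2)
        g = ℕ→ℚ (deg H v u)
      r≤ : r ≤ ε * (+ 1 / 4) * (ℕ→ℚ 3 * X * (ℕ→ℚ 3 * X))
      r≤ = ≤-trans (*-monoʳ-≤-0≤ (0≤ℕ→ℚ (N ℕ.^ 2)) ρ≤ε/4)
                   (≤-reflexive (cong (ε * (+ 1 / 4) *_) (trans (cong ℕ→ℚ (cong (N ℕ.*_) (ℕ.*-identityʳ N))) ℕ→ℚ-N²)))

    close : ∀ {ε ρ} → 0ℚ < ρ → ρ ≤ ε * (+ 1 / 4) → 0ℚ ≤ ε → 1ℚ ≤ X → 1ℚ ≤ ε * X →
            (∀ v u → ℕ→ℚ ((N ℕ.∸ 1) C 2) - ℕ→ℚ ((2 ℕ.* m) C 2) - ρ * ℕ→ℚ (N ℕ.^ 2) ≤ ℕ→ℚ (deg H v u)) →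
            ((+ 1 / 3) - ε * (+ 1 / 8)) * ℕ→ℚ N ≤ a → ((+ 2 / 3) - ε * (+ 1 / 8)) * ℕ→ℚ N ≤ ℕ→ℚ ∣ AP ∣ →
            ∣ W ∣ ≡ m → count D ≡ 0 ⊎ count S ≡ ∣ AP ∣ →
            E < ε * (+ 1 / 6) * ℕ→ℚ (e H) → Close ε H (H13copy W)
    close {ε} 0<ρ ρ≤ε/4 0≤ε 1≤X 1≤εX deg≥ a≥ AP≥ ∣W∣≡m D≡0⊎S≡AP E< = begin-strict
      ℕ→ℚ (missing (H13copy W) H)
        ≤⟨ ℕ→ℚ-mono-≤ (missing-≤ ∣W∣≡m) ⟩
      ℕ→ℚ (count (not ∘ lookup AQ) ℕ.* N³ ℕ.+ ∣ AQ ∣ ℕ.* K ℕ.+ 3 ℕ.* eInduced H AQ AP)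
        ≡⟨ ℕ→ℚ-missing-bound ⟩
      b * (ℕ→ℚ 3 * X * (ℕ→ℚ 3 * X * (ℕ→ℚ 3 * X))) + a * (k * (δ + (d + 1ℚ) * (ℕ→ℚ 2 * X + 1ℚ)) + d * c) + ℕ→ℚ 3 * E
        <⟨ estimate 0≤ε 1≤X 1≤εX (0≤ℕ→ℚ ∣ AQ ∣) (0≤ℕ→ℚ (count S)) (0≤ℕ→ℚ (count D)) (0≤ℕ→ℚ Δ) (0≤ℕ→ℚ ((N ℕ.∸ 1) C 2))
                    (b≤β 0≤ε 1≤X a≥) a≤X k≤2X (d≤β 0≤ε 1≤X ∣W∣≡m D≡0⊎S≡AP AP≥) (δ≤ {ε} (<⇒≤ 0<ρ) ρ≤ε/4 deg≥) c≤N² E≤ ⟩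
      ε * (ℕ→ℚ 4 * X * (ℕ→ℚ 4 * X) * (ℕ→ℚ 4 * X) * (ℕ→ℚ 4 * X))
        ≡⟨ cong (ε *_) (sym ℕ→ℚ-[4m]⁴) ⟩
      ε * ℕ→ℚ (4 ℕ.* m ℕ.* (4 ℕ.* m) ℕ.* (4 ℕ.* m) ℕ.* (4 ℕ.* m)) ∎
      where
      open ≤-Reasoning
      open Estimate ε X using (estimate)
      a≤X : a ≤ X
      a≤X = ℕ→ℚ-mono-≤ (∣p∣≤n AQ)
      k≤2X : k ≤ ℕ→ℚ 2 * X
      k≤2X = ≤-trans (ℕ→ℚ-mono-≤ (ℕ.≤-trans (ℕ.m≤m+n (count S) (count D)) (ℕ.≤-reflexive (count-S+D ∣W∣≡m))))
                     (≤-reflexive (ℕ→ℚ-* 2 m))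
      c≤N² : c ≤ ℕ→ℚ 3 * X * (ℕ→ℚ 3 * X)
      c≤N² = ≤-trans (ℕ→ℚ-mono-≤ (ℕ.≤-trans (C2≤square (N ℕ.∸ 1)) (ℕ.*-mono-≤ (ℕ.m∸n≤m N 1) (ℕ.m∸n≤m N 1))))
                     (≤-reflexive ℕ→ℚ-N²)
      E≤ : E ≤ ε * (+ 1 / 6) * (X * (ℕ→ℚ 3 * X * (ℕ→ℚ 3 * X * (ℕ→ℚ 3 * X))))
      E≤ = ≤-trans (<⇒≤ E<) (*-monoˡ-≤-0≤ (0≤* 0≤ε (toWitness {a? = 0ℚ ≤? (+ 1 / 6)} tt))
                     (≤-trans (ℕ→ℚ-mono-≤ (e≤ H)) (≤-reflexive (trans (ℕ→ℚ-* m N³) (cong (X *_) ℕ→ℚ-N³)))))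
      ℕ→ℚ-[4m]⁴ : ℕ→ℚ (4 ℕ.* m ℕ.* (4 ℕ.* m) ℕ.* (4 ℕ.* m) ℕ.* (4 ℕ.* m))
                  ≡ ℕ→ℚ 4 * X * (ℕ→ℚ 4 * X) * (ℕ→ℚ 4 * X) * (ℕ→ℚ 4 * X)
      ℕ→ℚ-[4m]⁴ = trans (ℕ→ℚ-* (4 ℕ.* m ℕ.* (4 ℕ.* m) ℕ.* (4 ℕ.* m)) (4 ℕ.* m))
                  (cong₂ _*_ (trans (ℕ→ℚ-* (4 ℕ.* m ℕ.* (4 ℕ.* m)) (4 ℕ.* m))
                  (cong₂ _*_ (trans (ℕ→ℚ-* (4 ℕ.* m) (4 ℕ.* m)) (cong₂ _*_ 4m 4m)) 4m)) 4m)
        where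
        4m : ℕ→ℚ (4 ℕ.* m) ≡ ℕ→ℚ 4 * X
        4m = ℕ→ℚ-* 4 m

open import Defs
open import Data.Nat using (ℕ; _∸_; _^_) renaming (_*_ to _*ℕ_; _≤_ to _≤ℕ_)
open import Data.Nat.Combinatorics using (_C_)
open import Data.Fin.Subset using (Subset; ∣_∣)
open import Data.Integer using (+_)
open import Data.Rational using (ℚ; 0ℚ; _/_; _+_; _-_; _*_; _≤_; _<_)
open import Data.Product using (Σ; _×_)
open import Relation.Binary.PropositionalEquality using (_≡_)
open import Relation.Nullary using (¬_)

import Data.Nat as ℕ
import Data.Nat.Properties as ℕ
open import Data.Rational using (1ℚ)
open import Data.Rational.Properties using (≮⇒≥; ≤-trans; <⇒≤)
open import Data.Product using (_,_)
open Counting using (choose-W)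
open RationalEstimates

lemma4p2 : Σ ℚ λ ε₀ → 0ℚ < ε₀ × (∀ (ε ρ : ℚ) → 0ℚ < ρ → ρ ≤ ε * (+ 1 / 4) → ε ≤ ε₀ →
    Σ ℕ λ n₀ → ∀ (m : ℕ) → n₀ ≤ℕ 3 *ℕ m → (H : Graph13 m) →
    (∀ v u → ℕ→ℚ (((3 *ℕ m) ∸ 1) C 2) - ℕ→ℚ ((2 *ℕ m) C 2) - ρ * ℕ→ℚ ((3 *ℕ m) ^ 2) ≤ ℕ→ℚ (deg H v u)) →
    (∀ (W : Subset (3 *ℕ m)) → ∣ W ∣ ≡ m → ¬ Close ε H (H13copy W)) →
    ∀ (AQ : Subset m) (AP : Subset (3 *ℕ m)) →
    ((+ 1 / 3) - ε * (+ 1 / 8)) * ℕ→ℚ (3 *ℕ m) ≤ ℕ→ℚ ∣ AQ ∣ →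
    ((+ 2 / 3) - ε * (+ 1 / 8)) * ℕ→ℚ (3 *ℕ m) ≤ ℕ→ℚ ∣ AP ∣ →
    (ε * (+ 1 / 6)) * ℕ→ℚ (e H) ≤ ℕ→ℚ (eInduced H AQ AP))
-- The count works for every ε > 0.
lemma4p2 = 1ℚ , 0<1 , λ ε ρ 0<ρ ρ≤ε/4 _ →
  let 0<ε = 0<ε-of-ρ 0<ρ ρ≤ε/4
      k , 1≤ε[k+1] = archimedean ε 0<ε
  in 3 *ℕ ℕ.suc k , λ m 3[k+1]≤3m H deg≥ far AQ AP AQ≥ AP≥ →
    let k+1≤m : ℕ.suc k ≤ℕ m
        k+1≤m = ℕ.*-cancelˡ-≤ 3 3[k+1]≤3m
        W , ∣W∣≡m , D≡0⊎S≡AP = choose-W m AP (ℕ.m≤n*m m 3)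
        1≤m : 1ℚ ≤ ℕ→ℚ m
        1≤m = ℕ→ℚ-mono-≤ (ℕ.≤-trans (ℕ.s≤s ℕ.z≤n) k+1≤m)
        1≤εm : 1ℚ ≤ ε * ℕ→ℚ m
        1≤εm = ≤-trans 1≤ε[k+1] (*-monoˡ-≤-0≤ (<⇒≤ 0<ε) (ℕ→ℚ-mono-≤ k+1≤m))
    in ≮⇒≥ λ sparse → far W ∣W∣≡m
         (Closeness.close H W AP AQ 0<ρ ρ≤ε/4 (<⇒≤ 0<ε) 1≤m 1≤εm deg≥ AQ≥ AP≥ ∣W∣≡m D≡0⊎S≡AP sparse)
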